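{- Let $G=(V,E)$ be a finite graph, $W\subseteq V$ with $|W|=w$, $u\in\mathbb{N}$, and $Y=\mathcal{S}_u(W)$. Suppose that $Y\cup W$ is a sieve in $G$ and that no two distinct vertices of $Y$ have the same set of neighbours in $W$. Then $D_2(G)\le u+w+4$.
   Context: For $X\subseteq V$, define $x\equiv_X y$ iff $x=y$ or ($x,y\in V\setminus X$ and $\Gamma(x)\cap X=\Gamma(y)\cap X$), $\Gamma$ denoting neighbourhood; $\mathcal{S}(X)$ is the set of $x\in V$ such that no $y\ne x$ satisfies $y\equiv_X x$; $X$ is a sieve if $\mathcal{S}(X)=V$. For $W\subseteq V$ and $u\in\mathbb{N}$, $\mathcal{S}_u(W)=\bigcup_{U\subseteq V\setminus W,\ |U|=u}\bigl(\mathcal{S}(U\cup W)\setminus(U\cup W)\bigr)$. First order sentences about graphs use variables over vertices, relations $=$ and $\sim$, quantifiers $\forall,\exists$, Boolean connectives; quantifier depth is the maximum number of nested quantifiers. A sentence $A$ defines $G$ if $G\models A$ and $H\not\models A$ for all $H\not\cong G$. For a sentence with no quantifier in the scope of a negation, the alternation number is the maximum number of changes between $\exists$ and $\forall$ along a chain of nested quantifiers. $D_2(G)$ is the minimum depth of a sentence with alternation number at most $2$ defining $G$. -}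

module Defs where

open import Data.Nat using (ℕ; zero; suc; _+_; _⊔_; _≤_)
open import Data.Fin using (Fin; zero; suc)
open import Data.Fin.Subset using (Subset; _∈_; _∉_; ∣_∣)
open import Data.Bool using (Bool; true; false)
open import Data.Product using (Σ; _×_; ∃; _,_)
open import Data.Sum using (_⊎_)
open import Data.Maybe using (Maybe; just; nothing)
open import Data.Empty using (⊥)
open import Data.Unit using (⊤)
open import Relation.Nullary using (¬_)
open import Relation.Binary.PropositionalEquality using (_≡_; _≢_)

record Graph : Set where
  field
    n      : ℕ
    adj    : Fin n → Fin n → Bool
    sym    : ∀ x y → adj x y ≡ adj y x
    irrefl : ∀ x → adj x x ≡ false

open Graph public

record _≅_ (G H : Graph) : Set where
  field
    to      : Fin (n G) → Fin (n H)
    from    : Fin (n H) → Fin (n G)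
    from∘to : ∀ x → from (to x) ≡ x
    to∘from : ∀ y → to (from y) ≡ y
    adj-pres : ∀ x y → adj H (to x) (to y) ≡ adj G x y

VSet : Graph → Set₁
VSet G = Fin (n G) → Set

SameNbhdIn : (G : Graph) → VSet G → Fin (n G) → Fin (n G) → Set
SameNbhdIn G X x y = ∀ z → X z → adj G x z ≡ adj G y z

EquivX : (G : Graph) → VSet G → Fin (n G) → Fin (n G) → Set
EquivX G X x y = x ≡ y ⊎ (¬ X x × ¬ X y × SameNbhdIn G X x y)

Sep : (G : Graph) → VSet G → VSet G
Sep G X x = ∀ y → y ≢ x → ¬ EquivX G X y x

IsSieve : (G : Graph) → VSet G → Set
IsSieve G X = ∀ x → Sep G X x

_∪ᵖ_ : {G : Graph} → VSet G → VSet G → VSet G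
(A ∪ᵖ B) x = A x ⊎ B x

Sepᵤ : (G : Graph) → ℕ → Subset (n G) → VSet G
Sepᵤ G u W x =
  Σ (Subset (n G)) λ U →
    (∀ z → z ∈ U → z ∉ W) × ∣ U ∣ ≡ u ×
    Sep G (_∪ᵖ_ {G} (_∈ U) (_∈ W)) x × ¬ (x ∈ U ⊎ x ∈ W)

-- First-order logic of graphs; formulas with k free variables (de Bruijn)

data Formula : ℕ → Set where
  _≐_  : ∀ {k} → Fin k → Fin k → Formula k
  _∼_  : ∀ {k} → Fin k → Fin k → Formula k
  ¬ᶠ_  : ∀ {k} → Formula k → Formula k
  _∧ᶠ_ : ∀ {k} → Formula k → Formula k → Formula k
  _∨ᶠ_ : ∀ {k} → Formula k → Formula k → Formula k
  ∃ᶠ   : ∀ {k} → Formula (suc k) → Formula k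
  ∀ᶠ   : ∀ {k} → Formula (suc k) → Formula k

Sentence : Set
Sentence = Formula 0

extend : ∀ {k} {A : Set} → A → (Fin k → A) → Fin (suc k) → A
extend a ρ zero    = a
extend a ρ (suc i) = ρ i

Sat : (G : Graph) {k : ℕ} → (Fin k → Fin (n G)) → Formula k → Set
Sat G ρ (i ≐ j)  = ρ i ≡ ρ j
Sat G ρ (i ∼ j)  = adj G (ρ i) (ρ j) ≡ true
Sat G ρ (¬ᶠ φ)   = ¬ Sat G ρ φ
Sat G ρ (φ ∧ᶠ ψ) = Sat G ρ φ × Sat G ρ ψ
Sat G ρ (φ ∨ᶠ ψ) = Sat G ρ φ ⊎ Sat G ρ ψ
Sat G ρ (∃ᶠ φ)   = Σ (Fin (n G)) λ a → Sat G (extend a ρ) φ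
Sat G ρ (∀ᶠ φ)   = (a : Fin (n G)) → Sat G (extend a ρ) φ

noVars : {A : Set} → Fin 0 → A
noVars ()

_⊨_ : Graph → Sentence → Set
G ⊨ A = Sat G noVars A

Defines : Sentence → Graph → Set
Defines A G = G ⊨ A × (∀ H → ¬ (H ≅ G) → ¬ (H ⊨ A))

depth : ∀ {k} → Formula k → ℕ
depth (i ≐ j)  = 0
depth (i ∼ j)  = 0
depth (¬ᶠ φ)   = depth φ
depth (φ ∧ᶠ ψ) = depth φ ⊔ depth ψ
depth (φ ∨ᶠ ψ) = depth φ ⊔ depth ψ
depth (∃ᶠ φ)   = suc (depth φ)
depth (∀ᶠ φ)   = suc (depth φ)

QF : ∀ {k} → Formula k → Set
QF (i ≐ j)  = ⊤
QF (i ∼ j)  = ⊤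
QF (¬ᶠ φ)   = QF φ
QF (φ ∧ᶠ ψ) = QF φ × QF ψ
QF (φ ∨ᶠ ψ) = QF φ × QF ψ
QF (∃ᶠ φ)   = ⊥
QF (∀ᶠ φ)   = ⊥

NegQF : ∀ {k} → Formula k → Set
NegQF (i ≐ j)  = ⊤
NegQF (i ∼ j)  = ⊤
NegQF (¬ᶠ φ)   = QF φ
NegQF (φ ∧ᶠ ψ) = NegQF φ × NegQF ψ
NegQF (φ ∨ᶠ ψ) = NegQF φ × NegQF ψ
NegQF (∃ᶠ φ)   = NegQF φ
NegQF (∀ᶠ φ)   = NegQF φ

data QKind : Set where
  qE qA : QKind

changeTo : Maybe QKind → QKind → ℕ
changeTo (just qE) qA = 1
changeTo (just qA) qE = 1
changeTo _         _  = 0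

altFrom : ∀ {k} → Maybe QKind → Formula k → ℕ
altFrom q (i ≐ j)  = 0
altFrom q (i ∼ j)  = 0
altFrom q (¬ᶠ φ)   = altFrom q φ
altFrom q (φ ∧ᶠ ψ) = altFrom q φ ⊔ altFrom q ψ
altFrom q (φ ∨ᶠ ψ) = altFrom q φ ⊔ altFrom q ψ
altFrom q (∃ᶠ φ)   = changeTo q qE + altFrom (just qE) φ
altFrom q (∀ᶠ φ)   = changeTo q qA + altFrom (just qA) φ

alternation : ∀ {k} → Formula k → ℕ
alternation = altFrom nothing

-- D₂(G) ≤ d  (D₂ being a minimum, this says some admissible defining sentence has depth ≤ d)
D₂≤ : Graph → ℕ → Set
D₂≤ G d = Σ Sentence λ A →
  NegQF A × alternation A ≤ 2 × Defines A G × depth A ≤ d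

{-# OPTIONS --safe #-}
-- The defining sentence is ∃ω₁…ω_w. Φ, where Φ describes G relative to a copy ω
-- of W. Relative to ω, membership in 𝒮ᵤ is expressed by an ∃ᵘ∀ formula of depth
-- u + 1, and a vertex of Y = 𝒮ᵤ(W) is determined by its adjacency pattern to W.
-- So Φ can say that for every y ∈ Y some vertex of 𝒮ᵤ(ω) has y's pattern, and
-- that these representatives are adjacent as in G; it always refers to them
-- through a universal guard "for all a ∈ 𝒮ᵤ(ω) with pattern p". A remaining vertex
-- r ∈ R = V ∖ (Y ∪ W) is described by its type: its pattern on ω and its
-- adjacency to the representatives of Y. Because Y ∪ W is a sieve, distinct
-- vertices of R have distinct types, so Φ can say that each type of R is realised
-- exactly once outside 𝒮ᵤ(ω), that every vertex lies in ω, represents some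
-- y ∈ Y or has some type, and how the types are adjacent. G satisfies Φ with ω
-- enumerating W; in any model of Φ the map sending each vertex of G to its
-- representative is an isomorphism. The guards keep the quantifier prefixes within
-- ∃∀∃, and the depth is w + 3 + (u + 1).
module Submission where

open import Defs
open import Data.Bool using (Bool; true; false; not; if_then_else_)
open import Data.Bool.Properties using (¬-not; not-¬) renaming (_≟_ to _≟ᴮ_)
open import Data.Empty using (⊥-elim)
open import Data.Fin using (Fin; zero; suc; _↑ˡ_; _↑ʳ_; _≟_; splitAt)
open import Data.Fin.Properties using (any?; all?; ¬∀⟶∃¬; injective⇒≤; suc-injective)
open import Data.Fin.Subset using (Subset; _∈_; _∉_; ∣_∣)
open import Data.Fin.Subset.Properties using (_∈?_)
open import Data.Maybe using (just)
open import Data.Nat using (ℕ; zero; suc; _+_; _⊔_; _≤_; z≤n; s≤s)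
open import Data.Nat.Properties using (≤-refl; ≤-reflexive; ≤-trans; ≤-antisym; n≤1+n; ⊔-lub; m≤m⊔n; m≤n⊔m; m≤n+m; +-suc)
open import Data.Nat.Tactic.RingSolver using (solve-∀)
open import Data.Product using (∃; _×_; _,_; proj₁; proj₂)
open import Data.Product.Function.NonDependent.Propositional using (_×-⇔_)
open import Data.Sum using (_⊎_; inj₁; inj₂; [_,_]; [_,_]′)
open import Data.Sum.Function.Propositional using (_⊎-⇔_)
open import Data.Unit using (tt)
open import Data.Vec using (_∷_; tabulate; here; there)
open import Data.Vec.Properties using ([]=⇒lookup; lookup⇒[]=; lookup∘tabulate)
open import Data.Vec.Functional using (_++_)
open import Data.Vec.Functional.Properties using (lookup-++ˡ; lookup-++ʳ)
open import Function using (_∘_)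
open import Function.Bundles using (_⇔_; mk⇔; Equivalence)
open import Function.Definitions using (Injective)
open import Function.Properties.Equivalence using () renaming (refl to ⇔-refl; trans to ⇔-trans)
open import Function.Related.TypeIsomorphisms using (→-cong-⇔; ¬-cong-⇔)
open import Relation.Nullary using (¬_; Dec; yes; no; does)
open import Relation.Nullary.Decidable using (¬?; _×-dec_; _⊎-dec_; decidable-stable) renaming (map to map-dec)
open import Relation.Binary.PropositionalEquality as ≡ using (_≡_; _≢_; _≗_; refl; cong; cong₂; subst₂)

∀-cong : {I : Set} {P Q : I → Set} → (∀ i → P i ⇔ Q i) → (∀ i → P i) ⇔ (∀ i → Q i)
∀-cong P⇔Q = mk⇔ (λ p i → Equivalence.to (P⇔Q i) (p i)) (λ q i → Equivalence.from (P⇔Q i) (q i))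

subst₂-⇔ : ∀ {A B : Set} (P : A → B → Set) {a a′ b b′} → a ≡ a′ → b ≡ b′ → P a b ⇔ P a′ b′
subst₂-⇔ P refl refl = ⇔-refl

∃-cong : {I : Set} {P Q : I → Set} → (∀ i → P i ⇔ Q i) → ∃ P ⇔ ∃ Q
∃-cong P⇔Q = mk⇔ (λ (i , p) → i , Equivalence.to (P⇔Q i) p) (λ (i , q) → i , Equivalence.from (P⇔Q i) q)

-- Finite subsets as images of injective enumerations

does≡true⇔ : ∀ {A : Set} (A? : Dec A) → (does A? ≡ true) ⇔ A
does≡true⇔ (yes a) = mk⇔ (λ _ → a) (λ _ → refl)
does≡true⇔ (no ¬a) = mk⇔ (λ ()) (λ a → ⊥-elim (¬a a))

IsImage : ∀ {k m} → (Fin k → Fin m) → Subset m → Set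
IsImage v U = ∀ x → x ∈ U ⇔ ∃ λ j → x ≡ v j

image : ∀ {k m} → (Fin k → Fin m) → Subset m
image v = tabulate (λ x → does (any? (λ j → x ≟ v j)))

image-isImage : ∀ {k m} (v : Fin k → Fin m) → IsImage v (image v)
image-isImage v x = ⇔-trans ∈tabulate⇔ (does≡true⇔ (any? (λ j → x ≟ v j)))
  where
  f = λ y → does (any? (λ j → y ≟ v j))
  ∈tabulate⇔ : x ∈ tabulate f ⇔ (f x ≡ true)
  ∈tabulate⇔ = mk⇔ (λ x∈ → ≡.trans (≡.sym (lookup∘tabulate f x)) ([]=⇒lookup x∈))
                   (λ fx → lookup⇒[]= x _ (≡.trans (lookup∘tabulate f x) fx))

enum : ∀ {m} (p : Subset m) → Fin ∣ p ∣ → Fin m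
enum (true  ∷ p) zero    = zero
enum (true  ∷ p) (suc i) = suc (enum p i)
enum (false ∷ p) i       = suc (enum p i)

enum-∈ : ∀ {m} (p : Subset m) i → enum p i ∈ p
enum-∈ (true  ∷ p) zero    = here
enum-∈ (true  ∷ p) (suc i) = there (enum-∈ p i)
enum-∈ (false ∷ p) i       = there (enum-∈ p i)

enum-injective : ∀ {m} (p : Subset m) → Injective _≡_ _≡_ (enum p)
enum-injective (true  ∷ p) {zero}  {zero}  _  = refl
enum-injective (true  ∷ p) {suc i} {suc j} eq = cong suc (enum-injective p (suc-injective eq))
enum-injective (false ∷ p)                 eq = enum-injective p (suc-injective eq)

enum-surjective : ∀ {m} (p : Subset m) {x} → x ∈ p → ∃ λ i → x ≡ enum p i
enum-surjective (true  ∷ p) here      = zero , refl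
enum-surjective (true  ∷ p) (there h) = let (i , eq) = enum-surjective p h in suc i , cong suc eq
enum-surjective (false ∷ p) (there h) = let (i , eq) = enum-surjective p h in i , cong suc eq

enum-isImage : ∀ {m} (p : Subset m) → IsImage (enum p) p
enum-isImage p x = mk⇔ (enum-surjective p) (λ (i , eq) → ≡.subst (_∈ p) (≡.sym eq) (enum-∈ p i))

isImage-enumeration : ∀ {k m} (U : Subset m) → ∣ U ∣ ≡ k →
                      ∃ λ (v : Fin k → Fin m) → Injective _≡_ _≡_ v × IsImage v U
isImage-enumeration U refl = enum U , enum-injective U , enum-isImage U

isImage⇒∣∣≡ : ∀ {k m} {v : Fin k → Fin m} {U : Subset m} → Injective _≡_ _≡_ v → IsImage v U → ∣ U ∣ ≡ k
isImage⇒∣∣≡ {v = v} {U} v-inj U≡img = ≤-antisym (injective⇒≤ {f = into} into-inj) (injective⇒≤ {f = back} back-inj)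
  where
  index : ∀ {x} → x ∈ U → Fin _
  index x∈ = proj₁ (Equivalence.to (U≡img _) x∈)
  index-eq : ∀ {x} (x∈ : x ∈ U) → x ≡ v (index x∈)
  index-eq x∈ = proj₂ (Equivalence.to (U≡img _) x∈)
  into : Fin ∣ U ∣ → Fin _
  into i = index (enum-∈ U i)
  into-inj : Injective _≡_ _≡_ into
  into-inj {i} {j} eq = enum-injective U
    (≡.trans (index-eq (enum-∈ U i)) (≡.trans (cong v eq) (≡.sym (index-eq (enum-∈ U j)))))
  back : Fin _ → Fin ∣ U ∣
  back j = proj₁ (enum-surjective U (Equivalence.from (U≡img (v j)) (j , refl)))
  back-inj : Injective _≡_ _≡_ back
  back-inj {i} {j} eq = v-inj
    (≡.trans (proj₂ (enum-surjective U _)) (≡.trans (cong (enum U) eq) (≡.sym (proj₂ (enum-surjective U _)))))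

distinct⇒injective : ∀ {m k} {v : Fin m → Fin k} → (∀ j j′ → j ≢ j′ → v j ≢ v j′) → Injective _≡_ _≡_ v
distinct⇒injective {v = v} dist {j} {j′} eq with j ≟ j′
... | yes j≡j′ = j≡j′
... | no j≢j′ = ⊥-elim (dist j j′ j≢j′ eq)

neg : ∀ {k} → Formula k → Formula k
neg (i ≐ j)  = ¬ᶠ (i ≐ j)
neg (i ∼ j)  = ¬ᶠ (i ∼ j)
neg (¬ᶠ φ)   = φ
neg (φ ∧ᶠ ψ) = neg φ ∨ᶠ neg ψ
neg (φ ∨ᶠ ψ) = neg φ ∧ᶠ neg ψ
neg (∃ᶠ φ)   = ∀ᶠ (neg φ)
neg (∀ᶠ φ)   = ∃ᶠ (neg φ)

infixr 1 _⇒ᶠ_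
_⇒ᶠ_ : ∀ {k} → Formula k → Formula k → Formula k
φ ⇒ᶠ ψ = neg φ ∨ᶠ ψ

∃ⁿ : ∀ {k} (m : ℕ) → Formula (m + k) → Formula k
∃ⁿ zero    φ = φ
∃ⁿ (suc m) φ = ∃ⁿ m (∃ᶠ φ)

-- There are no constants: ⊤ᶠ x and ⊥ᶠ x are quantifier-free but need a variable,
-- ⊤ₛ needs none but costs a quantifier.
⊤ₛ : ∀ {k} → Formula k
⊤ₛ = ∀ᶠ (zero ≐ zero)

⊤ᶠ ⊥ᶠ : ∀ {k} → Fin k → Formula k
⊤ᶠ x = x ≐ x
⊥ᶠ x = ¬ᶠ (x ≐ x)

⋀ ⋁ : ∀ {k} → Formula k → (m : ℕ) → (Fin m → Formula k) → Formula k
⋀ t zero    φ = t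
⋀ t (suc m) φ = φ zero ∧ᶠ ⋀ t m (φ ∘ suc)
⋁ f zero    φ = f
⋁ f (suc m) φ = φ zero ∨ᶠ ⋁ f m (φ ∘ suc)

-- ⋀∈ t P? φ is the conjunction of the φ i with P i; t serves both as the empty
-- conjunction and in place of the excluded i (dually for ⋁∈).
⋀∈ ⋁∈ : ∀ {k m} {P : Fin m → Set} → Formula k → (∀ i → Dec (P i)) → (Fin m → Formula k) → Formula k
⋀∈ {m = m} t P? φ = ⋀ t m (λ i → if does (P? i) then φ i else t)
⋁∈ {m = m} f P? φ = ⋁ f m (λ i → if does (P? i) then φ i else f)

adjIs : ∀ {k} → Bool → Fin k → Fin k → Formula k
adjIs true  x y = x ∼ y
adjIs false x y = ¬ᶠ (x ∼ y)

differ : ∀ {k} → Fin k → Fin k → Fin k → Formula k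
differ x y z = ((x ∼ z) ∧ᶠ (¬ᶠ (y ∼ z))) ∨ᶠ ((¬ᶠ (x ∼ z)) ∧ᶠ (y ∼ z))

outsideᶠ amongᶠ : ∀ {k m} → (Fin m → Fin k) → Fin k → Formula k
outsideᶠ τ x = ⋀ (⊤ᶠ x) _ (λ j → ¬ᶠ (x ≐ τ j))
amongᶠ   τ x = ⋁ (⊥ᶠ x) _ (λ j → x ≐ τ j)

separatedByᶠ : ∀ {k m} → (Fin m → Fin k) → Fin k → Fin k → Formula k
separatedByᶠ τ x y = ⋁ (⊥ᶠ x) _ (λ j → differ x y (τ j))

patternᶠ : ∀ {k m} → (Fin m → Fin k) → Fin k → (Fin m → Bool) → Formula k
patternᶠ τ x p = ⋀ (⊤ᶠ x) _ (λ j → adjIs (p j) x (τ j))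

distinctᶠ : ∀ {k m} → (Fin m → Fin k) → Formula k
distinctᶠ τ = ⋀ ⊤ₛ _ (λ j → ⋀∈ ⊤ₛ (λ j′ → ¬? (j ≟ j′)) (λ j′ → ¬ᶠ (τ j ≐ τ j′)))

-- Under ∃ⁿ u the witnesses are the variables j ↑ˡ k and the outer variables are shifted by u ↑ʳ_.
sepWitnessᶠ : ∀ {k m} (u : ℕ) → (Fin m → Fin k) → Fin k → Formula (u + k)
sepWitnessᶠ {k} u σ x =
  distinctᶠ vs ∧ᶠ (⋀ ⊤ₛ u (λ j → outsideᶠ σ′ (vs j)) ∧ᶠ (outsideᶠ vs x′ ∧ᶠ ∀ᶠ distinguished))
  where
  vs = _↑ˡ k
  σ′ = (u ↑ʳ_) ∘ σ
  x′ = u ↑ʳ x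
  distinguished = (zero ≐ suc x′) ∨ᶠ (amongᶠ (suc ∘ vs) zero ∨ᶠ (amongᶠ (suc ∘ σ′) zero ∨ᶠ
                  (separatedByᶠ (suc ∘ vs) zero (suc x′) ∨ᶠ separatedByᶠ (suc ∘ σ′) zero (suc x′))))

sepᵤᶠ : ∀ {k m} (u : ℕ) → (Fin m → Fin k) → Fin k → Formula k
sepᵤᶠ u σ x = outsideᶠ σ x ∧ᶠ ∃ⁿ u (sepWitnessᶠ u σ x)

-- Semantics

Env : Graph → ℕ → Set
Env K k = Fin k → Fin (n K)

extend-cong : ∀ {A : Set} {k} {ρ σ : Fin k → A} a → ρ ≗ σ → extend a ρ ≗ extend a σ
extend-cong a ρ≗σ zero    = refl
extend-cong a ρ≗σ (suc i) = ρ≗σ i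

++-extend : ∀ {A : Set} {m k} (v : Fin (suc m) → A) (ρ : Fin k → A) →
            v ++ ρ ≗ extend (v zero) ((v ∘ suc) ++ ρ)
++-extend v ρ zero = refl
++-extend {m = m} v ρ (suc i) with splitAt m i
... | inj₁ j = refl
... | inj₂ j = refl

module Semantics (K : Graph) where

  V : Set
  V = Fin (n K)

  Sat-cong : ∀ {k} {ρ σ : Env K k} (φ : Formula k) → ρ ≗ σ → Sat K ρ φ → Sat K σ φ
  Sat-cong (i ≐ j)  ρ≗σ s = ≡.trans (≡.sym (ρ≗σ i)) (≡.trans s (ρ≗σ j))
  Sat-cong (i ∼ j)  ρ≗σ s = subst₂ (λ a b → adj K a b ≡ true) (ρ≗σ i) (ρ≗σ j) s
  Sat-cong (¬ᶠ φ)   ρ≗σ s t = s (Sat-cong φ (≡.sym ∘ ρ≗σ) t)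
  Sat-cong (φ ∧ᶠ ψ) ρ≗σ (s , t) = Sat-cong φ ρ≗σ s , Sat-cong ψ ρ≗σ t
  Sat-cong (φ ∨ᶠ ψ) ρ≗σ (inj₁ s) = inj₁ (Sat-cong φ ρ≗σ s)
  Sat-cong (φ ∨ᶠ ψ) ρ≗σ (inj₂ t) = inj₂ (Sat-cong ψ ρ≗σ t)
  Sat-cong (∃ᶠ φ)   ρ≗σ (a , s) = a , Sat-cong φ (extend-cong a ρ≗σ) s
  Sat-cong (∀ᶠ φ)   ρ≗σ s a = Sat-cong φ (extend-cong a ρ≗σ) (s a)

  Sat? : ∀ {k} (ρ : Env K k) (φ : Formula k) → Dec (Sat K ρ φ)
  Sat? ρ (i ≐ j)  = ρ i ≟ ρ j
  Sat? ρ (i ∼ j)  = adj K (ρ i) (ρ j) ≟ᴮ true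
  Sat? ρ (¬ᶠ φ)   = ¬? (Sat? ρ φ)
  Sat? ρ (φ ∧ᶠ ψ) = Sat? ρ φ ×-dec Sat? ρ ψ
  Sat? ρ (φ ∨ᶠ ψ) = Sat? ρ φ ⊎-dec Sat? ρ ψ
  Sat? ρ (∃ᶠ φ)   = any? (λ a → Sat? (extend a ρ) φ)
  Sat? ρ (∀ᶠ φ)   = all? (λ a → Sat? (extend a ρ) φ)

  Sat-neg : ∀ {k} (ρ : Env K k) (φ : Formula k) → Sat K ρ (neg φ) ⇔ (¬ Sat K ρ φ)
  Sat-neg ρ (i ≐ j)  = ⇔-refl
  Sat-neg ρ (i ∼ j)  = ⇔-refl
  Sat-neg ρ (¬ᶠ φ)   = mk⇔ (λ s ¬s → ¬s s) (decidable-stable (Sat? ρ φ))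
  Sat-neg ρ (φ ∧ᶠ ψ) = mk⇔ to from
    where
    to : Sat K ρ (neg φ) ⊎ Sat K ρ (neg ψ) → ¬ (Sat K ρ φ × Sat K ρ ψ)
    to (inj₁ s) (p , _) = Equivalence.to (Sat-neg ρ φ) s p
    to (inj₂ s) (_ , q) = Equivalence.to (Sat-neg ρ ψ) s q
    from : ¬ (Sat K ρ φ × Sat K ρ ψ) → Sat K ρ (neg φ) ⊎ Sat K ρ (neg ψ)
    from ¬pq with Sat? ρ φ
    ... | yes p = inj₂ (Equivalence.from (Sat-neg ρ ψ) (λ q → ¬pq (p , q)))
    ... | no ¬p = inj₁ (Equivalence.from (Sat-neg ρ φ) ¬p)
  Sat-neg ρ (φ ∨ᶠ ψ) = mk⇔
    (λ (s , t) → [ Equivalence.to (Sat-neg ρ φ) s , Equivalence.to (Sat-neg ρ ψ) t ])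
    (λ ¬p⊎q → Equivalence.from (Sat-neg ρ φ) (¬p⊎q ∘ inj₁) , Equivalence.from (Sat-neg ρ ψ) (¬p⊎q ∘ inj₂))
  Sat-neg ρ (∃ᶠ φ)   = mk⇔
    (λ s (a , p) → Equivalence.to (Sat-neg (extend a ρ) φ) (s a) p)
    (λ ¬∃ a → Equivalence.from (Sat-neg (extend a ρ) φ) (λ p → ¬∃ (a , p)))
  Sat-neg ρ (∀ᶠ φ)   = mk⇔
    (λ (a , s) ∀p → Equivalence.to (Sat-neg (extend a ρ) φ) s (∀p a))
    (λ ¬∀ → let (a , ¬p) = ¬∀⟶∃¬ (n K) _ (λ a → Sat? (extend a ρ) φ) ¬∀
            in a , Equivalence.from (Sat-neg (extend a ρ) φ) ¬p)

  Sat-⇒ᶠ : ∀ {k} (ρ : Env K k) (φ ψ : Formula k) → Sat K ρ (φ ⇒ᶠ ψ) ⇔ (Sat K ρ φ → Sat K ρ ψ)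
  Sat-⇒ᶠ ρ φ ψ = mk⇔ to from
    where
    to : Sat K ρ (neg φ) ⊎ Sat K ρ ψ → Sat K ρ φ → Sat K ρ ψ
    to (inj₁ ¬p) p = ⊥-elim (Equivalence.to (Sat-neg ρ φ) ¬p p)
    to (inj₂ q)  _ = q
    from : (Sat K ρ φ → Sat K ρ ψ) → Sat K ρ (neg φ) ⊎ Sat K ρ ψ
    from p⇒q with Sat? ρ φ
    ... | yes p = inj₂ (p⇒q p)
    ... | no ¬p = inj₁ (Equivalence.from (Sat-neg ρ φ) ¬p)

  Sat-∃ⁿ : ∀ {k} (m : ℕ) (ρ : Env K k) (φ : Formula (m + k)) →
           Sat K ρ (∃ⁿ m φ) ⇔ ∃ λ (v : Fin m → Fin (n K)) → Sat K (v ++ ρ) φ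
  Sat-∃ⁿ zero    ρ φ = mk⇔ (λ s → (λ ()) , s) proj₂
  Sat-∃ⁿ (suc m) ρ φ = ⇔-trans (Sat-∃ⁿ m ρ (∃ᶠ φ)) (mk⇔
    (λ (v , a , s) → extend a v , Sat-cong φ (≡.sym ∘ ++-extend (extend a v) ρ) s)
    (λ (v , s) → v ∘ suc , v zero , Sat-cong φ (++-extend v ρ) s))

  Sat-⋀ : ∀ {k} (ρ : Env K k) {t} → Sat K ρ t → ∀ m (φ : Fin m → Formula k) →
          Sat K ρ (⋀ t m φ) ⇔ (∀ i → Sat K ρ (φ i))
  Sat-⋀ ρ ⊨t zero    φ = mk⇔ (λ _ ()) (λ _ → ⊨t)
  Sat-⋀ ρ ⊨t (suc m) φ = mk⇔
    (λ { (s , ss) zero → s ; (s , ss) (suc i) → Equivalence.to (Sat-⋀ ρ ⊨t m (φ ∘ suc)) ss i })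
    (λ ss → ss zero , Equivalence.from (Sat-⋀ ρ ⊨t m (φ ∘ suc)) (ss ∘ suc))

  Sat-⋁ : ∀ {k} (ρ : Env K k) {f} → ¬ Sat K ρ f → ∀ m (φ : Fin m → Formula k) →
          Sat K ρ (⋁ f m φ) ⇔ ∃ λ i → Sat K ρ (φ i)
  Sat-⋁ ρ ⊭f zero    φ = mk⇔ (λ s → ⊥-elim (⊭f s)) (λ ())
  Sat-⋁ ρ ⊭f (suc m) φ = mk⇔ to from
    where
    to : Sat K ρ (φ zero) ⊎ Sat K ρ (⋁ _ m (φ ∘ suc)) → ∃ λ i → Sat K ρ (φ i)
    to (inj₁ s)  = zero , s
    to (inj₂ ss) = let (i , s) = Equivalence.to (Sat-⋁ ρ ⊭f m (φ ∘ suc)) ss in suc i , s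
    from : (∃ λ i → Sat K ρ (φ i)) → Sat K ρ (φ zero) ⊎ Sat K ρ (⋁ _ m (φ ∘ suc))
    from (zero  , s) = inj₁ s
    from (suc i , s) = inj₂ (Equivalence.from (Sat-⋁ ρ ⊭f m (φ ∘ suc)) (i , s))

  Sat-⋀∈ : ∀ {k m} (ρ : Env K k) {t} → Sat K ρ t → {P : Fin m → Set} (P? : ∀ i → Dec (P i))
           (φ : Fin m → Formula k) → Sat K ρ (⋀∈ t P? φ) ⇔ (∀ i → P i → Sat K ρ (φ i))
  Sat-⋀∈ {m = m} ρ ⊨t P? φ = ⇔-trans (Sat-⋀ ρ ⊨t m _) (∀-cong guard)
    where
    guard : ∀ i → Sat K ρ (if does (P? i) then φ i else _) ⇔ (_ → Sat K ρ (φ i))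
    guard i with P? i
    ... | yes p = mk⇔ (λ s _ → s) (λ s → s p)
    ... | no ¬p = mk⇔ (λ _ p → ⊥-elim (¬p p)) (λ _ → ⊨t)

  Sat-⋁∈ : ∀ {k m} (ρ : Env K k) {f} → ¬ Sat K ρ f → {P : Fin m → Set} (P? : ∀ i → Dec (P i))
           (φ : Fin m → Formula k) → Sat K ρ (⋁∈ f P? φ) ⇔ ∃ λ i → P i × Sat K ρ (φ i)
  Sat-⋁∈ {m = m} ρ ⊭f P? φ = ⇔-trans (Sat-⋁ ρ ⊭f m _) (∃-cong guard)
    where
    guard : ∀ i → Sat K ρ (if does (P? i) then φ i else _) ⇔ (_ × Sat K ρ (φ i))
    guard i with P? i
    ... | yes p = mk⇔ (p ,_) proj₂
    ... | no ¬p = mk⇔ (λ s → ⊥-elim (⊭f s)) (λ (p , _) → ⊥-elim (¬p p))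

  Sat-adjIs : ∀ {k} (ρ : Env K k) b x y → Sat K ρ (adjIs b x y) ⇔ (adj K (ρ x) (ρ y) ≡ b)
  Sat-adjIs ρ true  x y = ⇔-refl
  Sat-adjIs ρ false x y = mk⇔ ¬-not not-¬

  Sat-differ : ∀ {k} (ρ : Env K k) x y z → Sat K ρ (differ x y z) ⇔ (adj K (ρ x) (ρ z) ≢ adj K (ρ y) (ρ z))
  Sat-differ ρ x y z = mk⇔ to from
    where
    to : Sat K ρ (differ x y z) → adj K (ρ x) (ρ z) ≢ adj K (ρ y) (ρ z)
    to (inj₁ (xz , ¬yz)) e = ¬yz (≡.trans (≡.sym e) xz)
    to (inj₂ (¬xz , yz)) e = ¬xz (≡.trans e yz)
    from : adj K (ρ x) (ρ z) ≢ adj K (ρ y) (ρ z) → Sat K ρ (differ x y z)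
    from ne with adj K (ρ x) (ρ z) | adj K (ρ y) (ρ z)
    ... | true  | true  = ⊥-elim (ne refl)
    ... | true  | false = inj₁ (refl , λ ())
    ... | false | true  = inj₂ ((λ ()) , refl)
    ... | false | false = ⊥-elim (ne refl)

  module _ {m} (xs : Fin m → V) where
    Outside Among : V → Set
    Outside a = ∀ j → a ≢ xs j
    Among   a = ∃ λ j → a ≡ xs j

    SeparatedBy : V → V → Set
    SeparatedBy a b = ∃ λ j → adj K a (xs j) ≢ adj K b (xs j)

    HasPattern : V → (Fin m → Bool) → Set
    HasPattern a p = ∀ j → adj K a (xs j) ≡ p j

    Distinct : Set
    Distinct = ∀ j j′ → j ≢ j′ → xs j ≢ xs j′

  module _ {k m} (ρ : Env K k) {τ : Fin m → Fin k} {ω : Fin m → Fin (n K)} (ρ∘τ≗ω : ρ ∘ τ ≗ ω) where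

    Sat-outside : ∀ x {a} → ρ x ≡ a → Sat K ρ (outsideᶠ τ x) ⇔ Outside ω a
    Sat-outside x ρx≡a = ⇔-trans (Sat-⋀ ρ refl m _) (∀-cong λ j → ¬-cong-⇔ (subst₂-⇔ _≡_ ρx≡a (ρ∘τ≗ω j)))

    Sat-among : ∀ x {a} → ρ x ≡ a → Sat K ρ (amongᶠ τ x) ⇔ Among ω a
    Sat-among x ρx≡a = ⇔-trans (Sat-⋁ ρ (λ ¬refl → ¬refl refl) m _) (∃-cong λ j → subst₂-⇔ _≡_ ρx≡a (ρ∘τ≗ω j))

    Sat-separatedBy : ∀ x y {a b} → ρ x ≡ a → ρ y ≡ b → Sat K ρ (separatedByᶠ τ x y) ⇔ SeparatedBy ω a b
    Sat-separatedBy x y ρx≡a ρy≡b = ⇔-trans (Sat-⋁ ρ (λ ¬refl → ¬refl refl) m _) (∃-cong λ j →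
      ⇔-trans (Sat-differ ρ x y (τ j))
              (¬-cong-⇔ (⇔-trans (subst₂-⇔ (λ c d → adj K c d ≡ adj K _ d) ρx≡a (ρ∘τ≗ω j))
                                 (subst₂-⇔ (λ c d → adj K _ d ≡ adj K c d) ρy≡b refl))))

    Sat-pattern : ∀ x {a} p → ρ x ≡ a → Sat K ρ (patternᶠ τ x p) ⇔ HasPattern ω a p
    Sat-pattern x p ρx≡a = ⇔-trans (Sat-⋀ ρ refl m _) (∀-cong λ j →
      ⇔-trans (Sat-adjIs ρ (p j) x (τ j)) (subst₂-⇔ (λ c d → adj K c d ≡ p j) ρx≡a (ρ∘τ≗ω j)))

    Sat-distinct : Sat K ρ (distinctᶠ τ) ⇔ Distinct ω
    Sat-distinct = ⇔-trans (Sat-⋀ ρ (λ _ → refl) m _) (∀-cong λ j →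
      ⇔-trans (Sat-⋀∈ ρ (λ _ → refl) (λ j′ → ¬? (j ≟ j′)) _) (∀-cong λ j′ →
        →-cong-⇔ ⇔-refl (¬-cong-⇔ (subst₂-⇔ _≡_ (ρ∘τ≗ω j) (ρ∘τ≗ω j′)))))

  -- InSᵤ u ω a says that a ∈ 𝒮ᵤ(ω) in K, the u-set U being enumerated by the witness v.
  module _ {m} (u : ℕ) (ω : Fin m → V) where
    Distinguished : (Fin u → V) → V → V → Set
    Distinguished v a z = z ≡ a ⊎ (Among v z ⊎ (Among ω z ⊎ (SeparatedBy v z a ⊎ SeparatedBy ω z a)))

    SepWitness : V → (Fin u → V) → Set
    SepWitness a v = Distinct v × ((∀ j → Outside ω (v j)) × (Outside v a × (∀ z → Distinguished v a z)))

    InSᵤ : V → Set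
    InSᵤ a = Outside ω a × ∃ (SepWitness a)

  Sat-sepᵤ : ∀ {k m} u (ρ : Env K k) {σ : Fin m → Fin k} {ω} → ρ ∘ σ ≗ ω → ∀ x {a} → ρ x ≡ a →
             Sat K ρ (sepᵤᶠ u σ x) ⇔ InSᵤ u ω a
  Sat-sepᵤ {k} u ρ {σ} {ω} ρ∘σ≗ω x {a} ρx≡a =
    Sat-outside ρ ρ∘σ≗ω x ρx≡a ×-⇔ ⇔-trans (Sat-∃ⁿ u ρ _) (∃-cong Sat-witness)
    where
    module _ (v : Fin u → V) where
      ρ′ = v ++ ρ
      ρ′∘vs≗v : ρ′ ∘ (_↑ˡ k) ≗ v
      ρ′∘vs≗v = lookup-++ˡ v ρ
      ρ′∘σ′≗ω : ρ′ ∘ (u ↑ʳ_) ∘ σ ≗ ω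
      ρ′∘σ′≗ω i = ≡.trans (lookup-++ʳ v ρ (σ i)) (ρ∘σ≗ω i)
      ρ′x′≡a : ρ′ (u ↑ʳ x) ≡ a
      ρ′x′≡a = ≡.trans (lookup-++ʳ v ρ x) ρx≡a

      Sat-witness : Sat K ρ′ (sepWitnessᶠ u σ x) ⇔ SepWitness u ω a v
      Sat-witness =
        Sat-distinct ρ′ ρ′∘vs≗v ×-⇔
        ⇔-trans (Sat-⋀ ρ′ (λ _ → refl) u _) (∀-cong λ j → Sat-outside ρ′ ρ′∘σ′≗ω (j ↑ˡ k) (ρ′∘vs≗v j)) ×-⇔
        Sat-outside ρ′ ρ′∘vs≗v (u ↑ʳ x) ρ′x′≡a ×-⇔
        ∀-cong λ z → let ρ″ = extend z ρ′ in
          subst₂-⇔ _≡_ refl ρ′x′≡a ⊎-⇔ Sat-among ρ″ ρ′∘vs≗v zero refl ⊎-⇔ Sat-among ρ″ ρ′∘σ′≗ω zero refl ⊎-⇔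
          Sat-separatedBy ρ″ ρ′∘vs≗v zero (suc (u ↑ʳ x)) refl ρ′x′≡a ⊎-⇔
          Sat-separatedBy ρ″ ρ′∘σ′≗ω zero (suc (u ↑ʳ x)) refl ρ′x′≡a

-- Depth and alternation bounds

-- Alternations are bounded both below an enclosing ∃ (e) and below an
-- enclosing ∀ (a): negation swaps the two, which keeps the bounds compositional.
record Shape {k} (φ : Formula k) (d e a : ℕ) : Set where
  constructor shape
  field
    negQF  : NegQF φ
    depth≤ : depth φ ≤ d
    alt∃≤  : altFrom (just qE) φ ≤ e
    alt∀≤  : altFrom (just qA) φ ≤ a

shape-weaken : ∀ {k} {φ : Formula k} {d e a d′ e′ a′} → Shape φ d e a → d ≤ d′ → e ≤ e′ → a ≤ a′ → Shape φ d′ e′ a′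
shape-weaken (shape q d e a) d≤ e≤ a≤ = shape q (≤-trans d d≤) (≤-trans e e≤) (≤-trans a a≤)

shape-≐ : ∀ {k} (i j : Fin k) {d e a} → Shape (i ≐ j) d e a
shape-≐ i j = shape tt z≤n z≤n z≤n

shape-≠ : ∀ {k} (i j : Fin k) {d e a} → Shape (¬ᶠ (i ≐ j)) d e a
shape-≠ i j = shape tt z≤n z≤n z≤n

shape-adjIs : ∀ {k} b (x y : Fin k) {d e a} → Shape (adjIs b x y) d e a
shape-adjIs true  x y = shape tt z≤n z≤n z≤n
shape-adjIs false x y = shape tt z≤n z≤n z≤n

shape-∧ : ∀ {k} {φ ψ : Formula k} {d e a} → Shape φ d e a → Shape ψ d e a → Shape (φ ∧ᶠ ψ) d e a
shape-∧ (shape q d e a) (shape q′ d′ e′ a′) = shape (q , q′) (⊔-lub d d′) (⊔-lub e e′) (⊔-lub a a′)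

shape-∨ : ∀ {k} {φ ψ : Formula k} {d e a} → Shape φ d e a → Shape ψ d e a → Shape (φ ∨ᶠ ψ) d e a
shape-∨ (shape q d e a) (shape q′ d′ e′ a′) = shape (q , q′) (⊔-lub d d′) (⊔-lub e e′) (⊔-lub a a′)

shape-∃ : ∀ {k} {φ : Formula (suc k)} {d e a} → Shape φ d e a → Shape (∃ᶠ φ) (suc d) e (suc e)
shape-∃ (shape q d e a) = shape q (s≤s d) e (s≤s e)

shape-∀ : ∀ {k} {φ : Formula (suc k)} {d e a} → Shape φ d e a → Shape (∀ᶠ φ) (suc d) (suc a) a
shape-∀ (shape q d e a) = shape q (s≤s d) (s≤s a) a

shape-differ : ∀ {k} (x y z : Fin k) {d e a} → Shape (differ x y z) d e a
shape-differ x y z = shape-∨ (shape-∧ (shape-adjIs true x z) (shape-adjIs false y z))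
                             (shape-∧ (shape-adjIs false x z) (shape-adjIs true y z))

shape-⊤ₛ : ∀ {k d e a} → Shape (⊤ₛ {k}) (suc d) (suc e) a
shape-⊤ₛ = shape tt (s≤s z≤n) (s≤s z≤n) z≤n

shape-∃ⁿ : ∀ {k} (m : ℕ) {φ : Formula (m + k)} {d e a} → Shape φ d e a → a ≤ suc e → Shape (∃ⁿ m φ) (m + d) e (suc e)
shape-∃ⁿ zero    s a≤ = shape-weaken s ≤-refl ≤-refl a≤
shape-∃ⁿ (suc m) {d = d} s a≤ = shape-weaken (shape-∃ⁿ m (shape-∃ s) ≤-refl) (≤-reflexive (+-suc m d)) ≤-refl ≤-refl

shape-⋀ : ∀ {k} {t : Formula k} m {φ : Fin m → Formula k} {d e a} →
          Shape t d e a → (∀ i → Shape (φ i) d e a) → Shape (⋀ t m φ) d e a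
shape-⋀ zero    st sφ = st
shape-⋀ (suc m) st sφ = shape-∧ (sφ zero) (shape-⋀ m st (sφ ∘ suc))

shape-⋁ : ∀ {k} {f : Formula k} m {φ : Fin m → Formula k} {d e a} →
          Shape f d e a → (∀ i → Shape (φ i) d e a) → Shape (⋁ f m φ) d e a
shape-⋁ zero    sf sφ = sf
shape-⋁ (suc m) sf sφ = shape-∨ (sφ zero) (shape-⋁ m sf (sφ ∘ suc))

shape-if : ∀ {k} b {φ ψ : Formula k} {d e a} → Shape φ d e a → Shape ψ d e a → Shape (if b then φ else ψ) d e a
shape-if true  sφ sψ = sφ
shape-if false sφ sψ = sψ

shape-⋀∈ : ∀ {k m} {t : Formula k} {P : Fin m → Set} (P? : ∀ i → Dec (P i)) {φ : Fin m → Formula k} {d e a} →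
           Shape t d e a → (∀ i → Shape (φ i) d e a) → Shape (⋀∈ t P? φ) d e a
shape-⋀∈ {m = m} P? st sφ = shape-⋀ m st (λ i → shape-if (does (P? i)) (sφ i) st)

shape-⋁∈ : ∀ {k m} {f : Formula k} {P : Fin m → Set} (P? : ∀ i → Dec (P i)) {φ : Fin m → Formula k} {d e a} →
           Shape f d e a → (∀ i → Shape (φ i) d e a) → Shape (⋁∈ f P? φ) d e a
shape-⋁∈ {m = m} P? sf sφ = shape-⋁ m sf (λ i → shape-if (does (P? i)) (sφ i) sf)

QF⇒NegQF : ∀ {k} (φ : Formula k) → QF φ → NegQF φ
QF⇒NegQF (i ≐ j)  _        = tt
QF⇒NegQF (i ∼ j)  _        = tt
QF⇒NegQF (¬ᶠ φ)   q        = q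
QF⇒NegQF (φ ∧ᶠ ψ) (q , q′) = QF⇒NegQF φ q , QF⇒NegQF ψ q′
QF⇒NegQF (φ ∨ᶠ ψ) (q , q′) = QF⇒NegQF φ q , QF⇒NegQF ψ q′

QF⇒alt≡0 : ∀ {k} q (φ : Formula k) → QF φ → altFrom q φ ≡ 0
QF⇒alt≡0 q (i ≐ j)  _        = refl
QF⇒alt≡0 q (i ∼ j)  _        = refl
QF⇒alt≡0 q (¬ᶠ φ)   h        = QF⇒alt≡0 q φ h
QF⇒alt≡0 q (φ ∧ᶠ ψ) (h , h′) = cong₂ _⊔_ (QF⇒alt≡0 q φ h) (QF⇒alt≡0 q ψ h′)
QF⇒alt≡0 q (φ ∨ᶠ ψ) (h , h′) = cong₂ _⊔_ (QF⇒alt≡0 q φ h) (QF⇒alt≡0 q ψ h′)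

negQF-neg : ∀ {k} (φ : Formula k) → NegQF φ → NegQF (neg φ)
negQF-neg (i ≐ j)  _        = tt
negQF-neg (i ∼ j)  _        = tt
negQF-neg (¬ᶠ φ)   h        = QF⇒NegQF φ h
negQF-neg (φ ∧ᶠ ψ) (h , h′) = negQF-neg φ h , negQF-neg ψ h′
negQF-neg (φ ∨ᶠ ψ) (h , h′) = negQF-neg φ h , negQF-neg ψ h′
negQF-neg (∃ᶠ φ)   h        = negQF-neg φ h
negQF-neg (∀ᶠ φ)   h        = negQF-neg φ h

depth-neg : ∀ {k} (φ : Formula k) → depth (neg φ) ≡ depth φ
depth-neg (i ≐ j)  = refl
depth-neg (i ∼ j)  = refl
depth-neg (¬ᶠ φ)   = refl
depth-neg (φ ∧ᶠ ψ) = cong₂ _⊔_ (depth-neg φ) (depth-neg ψ)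
depth-neg (φ ∨ᶠ ψ) = cong₂ _⊔_ (depth-neg φ) (depth-neg ψ)
depth-neg (∃ᶠ φ)   = cong suc (depth-neg φ)
depth-neg (∀ᶠ φ)   = cong suc (depth-neg φ)

alt∃-neg : ∀ {k} (φ : Formula k) → NegQF φ → altFrom (just qE) (neg φ) ≡ altFrom (just qA) φ
alt∀-neg : ∀ {k} (φ : Formula k) → NegQF φ → altFrom (just qA) (neg φ) ≡ altFrom (just qE) φ
alt∃-neg (i ≐ j)  _        = refl
alt∃-neg (i ∼ j)  _        = refl
alt∃-neg (¬ᶠ φ)   h        = ≡.trans (QF⇒alt≡0 _ φ h) (≡.sym (QF⇒alt≡0 _ φ h))
alt∃-neg (φ ∧ᶠ ψ) (h , h′) = cong₂ _⊔_ (alt∃-neg φ h) (alt∃-neg ψ h′)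
alt∃-neg (φ ∨ᶠ ψ) (h , h′) = cong₂ _⊔_ (alt∃-neg φ h) (alt∃-neg ψ h′)
alt∃-neg (∃ᶠ φ)   h        = cong suc (alt∀-neg φ h)
alt∃-neg (∀ᶠ φ)   h        = alt∃-neg φ h
alt∀-neg (i ≐ j)  _        = refl
alt∀-neg (i ∼ j)  _        = refl
alt∀-neg (¬ᶠ φ)   h        = ≡.trans (QF⇒alt≡0 _ φ h) (≡.sym (QF⇒alt≡0 _ φ h))
alt∀-neg (φ ∧ᶠ ψ) (h , h′) = cong₂ _⊔_ (alt∀-neg φ h) (alt∀-neg ψ h′)
alt∀-neg (φ ∨ᶠ ψ) (h , h′) = cong₂ _⊔_ (alt∀-neg φ h) (alt∀-neg ψ h′)
alt∀-neg (∃ᶠ φ)   h        = alt∀-neg φ h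
alt∀-neg (∀ᶠ φ)   h        = cong suc (alt∃-neg φ h)

shape-neg : ∀ {k} {φ : Formula k} {d e a} → Shape φ d e a → Shape (neg φ) d a e
shape-neg {φ = φ} (shape q d e a) =
  shape (negQF-neg φ q) (≤-trans (≤-reflexive (depth-neg φ)) d)
        (≤-trans (≤-reflexive (alt∃-neg φ q)) a) (≤-trans (≤-reflexive (alt∀-neg φ q)) e)

shape-⇒ : ∀ {k} {φ ψ : Formula k} {d e a} → Shape φ d a e → Shape ψ d e a → Shape (φ ⇒ᶠ ψ) d e a
shape-⇒ sφ sψ = shape-∨ (shape-neg sφ) sψ

alternation≤alt∃ : ∀ {k} (φ : Formula k) → alternation φ ≤ altFrom (just qE) φ
alternation≤alt∃ (i ≐ j)  = z≤n
alternation≤alt∃ (i ∼ j)  = z≤n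
alternation≤alt∃ (¬ᶠ φ)   = alternation≤alt∃ φ
alternation≤alt∃ (φ ∧ᶠ ψ) = ⊔-lub (≤-trans (alternation≤alt∃ φ) (m≤m⊔n _ _)) (≤-trans (alternation≤alt∃ ψ) (m≤n⊔m _ _))
alternation≤alt∃ (φ ∨ᶠ ψ) = ⊔-lub (≤-trans (alternation≤alt∃ φ) (m≤m⊔n _ _)) (≤-trans (alternation≤alt∃ ψ) (m≤n⊔m _ _))
alternation≤alt∃ (∃ᶠ φ)   = ≤-refl
alternation≤alt∃ (∀ᶠ φ)   = m≤n+m _ 1

shape-outside : ∀ {k m} (τ : Fin m → Fin k) x {d e a} → Shape (outsideᶠ τ x) d e a
shape-outside τ x = shape-⋀ _ (shape-≐ x x) (λ j → shape-≠ x (τ j))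

shape-among : ∀ {k m} (τ : Fin m → Fin k) x {d e a} → Shape (amongᶠ τ x) d e a
shape-among τ x = shape-⋁ _ (shape-≠ x x) (λ j → shape-≐ x (τ j))

shape-separatedBy : ∀ {k m} (τ : Fin m → Fin k) x y {d e a} → Shape (separatedByᶠ τ x y) d e a
shape-separatedBy τ x y = shape-⋁ _ (shape-≠ x x) (λ j → shape-differ x y (τ j))

shape-pattern : ∀ {k m} (τ : Fin m → Fin k) x p {d e a} → Shape (patternᶠ τ x p) d e a
shape-pattern τ x p = shape-⋀ _ (shape-≐ x x) (λ j → shape-adjIs (p j) x (τ j))

shape-distinct : ∀ {k m} (τ : Fin m → Fin k) {d e a} → Shape (distinctᶠ τ) (suc d) (suc e) a
shape-distinct τ = shape-⋀ _ shape-⊤ₛ (λ j → shape-⋀∈ (λ j′ → ¬? (j ≟ j′)) shape-⊤ₛ (λ j′ → shape-≠ (τ j) (τ j′)))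

shape-sepᵤ : ∀ {k m} u (σ : Fin m → Fin k) x → Shape (sepᵤᶠ u σ x) (u + 1) 1 2
shape-sepᵤ {k} u σ x = shape-∧ (shape-outside σ x) (shape-∃ⁿ u witness z≤n)
  where
  vs = _↑ˡ k
  σ′ = (u ↑ʳ_) ∘ σ
  x′ = u ↑ʳ x
  witness : Shape (sepWitnessᶠ u σ x) 1 1 0
  witness = shape-∧ (shape-distinct vs) (shape-∧ (shape-⋀ u shape-⊤ₛ (λ j → shape-outside σ′ (vs j)))
    (shape-∧ (shape-outside vs x′) (shape-∀ {e = 0} (shape-∨ (shape-≐ zero (suc x′))
      (shape-∨ (shape-among (suc ∘ vs) zero) (shape-∨ (shape-among (suc ∘ σ′) zero)
        (shape-∨ (shape-separatedBy (suc ∘ vs) zero (suc x′)) (shape-separatedBy (suc ∘ σ′) zero (suc x′)))))))))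

-- 𝒮ᵤ(W) through enumerations of W and of U

module _ (K : Graph) where
  open Semantics K

  module _ {m} {ω : Fin m → V} {W : Subset (n K)} (W≡ω : IsImage ω W) where

    outside⇔∉ : ∀ {a} → Outside ω a ⇔ a ∉ W
    outside⇔∉ = mk⇔ (λ out a∈W → let (i , eq) = Equivalence.to (W≡ω _) a∈W in out i eq)
                    (λ a∉W i eq → a∉W (Equivalence.from (W≡ω _) (i , eq)))

    module _ {u} {v : Fin u → V} {U : Subset (n K)} (U≡v : IsImage v U) where
      private
        X : VSet K
        X = _∪ᵖ_ {K} (_∈ U) (_∈ W)

      sep⇒distinguished : ∀ {a} → ¬ X a → Sep K X a → ∀ z → Distinguished u ω v a z
      sep⇒distinguished {a} a∉X sep z with z ≟ a
      ... | yes z≡a = inj₁ z≡a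
      ... | no z≢a with z ∈? U | z ∈? W
      ...   | yes z∈U | _       = inj₂ (inj₁ (Equivalence.to (U≡v z) z∈U))
      ...   | no _    | yes z∈W = inj₂ (inj₂ (inj₁ (Equivalence.to (W≡ω z) z∈W)))
      ...   | no z∉U  | no z∉W with any? (λ j → ¬? (adj K z (v j) ≟ᴮ adj K a (v j)))
                                 | any? (λ i → ¬? (adj K z (ω i) ≟ᴮ adj K a (ω i)))
      ...     | yes sepU | _        = inj₂ (inj₂ (inj₂ (inj₁ sepU)))
      ...     | no _     | yes sepW = inj₂ (inj₂ (inj₂ (inj₂ sepW)))
      ...     | no ¬sepU | no ¬sepW = ⊥-elim (sep z z≢a (inj₂ ([ z∉U , z∉W ] , a∉X , same)))
        where
        same : SameNbhdIn K X z a
        same y (inj₁ y∈U) with Equivalence.to (U≡v y) y∈U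
        ... | j , refl = decidable-stable (_ ≟ᴮ _) (λ ne → ¬sepU (j , ne))
        same y (inj₂ y∈W) with Equivalence.to (W≡ω y) y∈W
        ... | i , refl = decidable-stable (_ ≟ᴮ _) (λ ne → ¬sepW (i , ne))

      distinguished⇒sep : ∀ {a} → (∀ z → Distinguished u ω v a z) → Sep K X a
      distinguished⇒sep dist z z≢a (inj₁ z≡a) = z≢a z≡a
      distinguished⇒sep dist z z≢a (inj₂ (z∉X , _ , same)) with dist z
      ... | inj₁ z≡a = z≢a z≡a
      ... | inj₂ (inj₁ z∈v) = z∉X (inj₁ (Equivalence.from (U≡v z) z∈v))
      ... | inj₂ (inj₂ (inj₁ z∈ω)) = z∉X (inj₂ (Equivalence.from (W≡ω z) z∈ω))
      ... | inj₂ (inj₂ (inj₂ (inj₁ (j , ne)))) = ne (same (v j) (inj₁ (Equivalence.from (U≡v _) (j , refl))))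
      ... | inj₂ (inj₂ (inj₂ (inj₂ (i , ne)))) = ne (same (ω i) (inj₂ (Equivalence.from (W≡ω _) (i , refl))))

  module _ (u : ℕ) (W : Subset (n K)) where

    Sepᵤ⇒InSᵤ : ∀ {a} → Sepᵤ K u W a → InSᵤ u (enum W) a
    Sepᵤ⇒InSᵤ {a} (U , U∩W≡∅ , ∣U∣≡u , sep , a∉X) =
      let (v , v-inj , U≡v) = isImage-enumeration U ∣U∣≡u in
      Equivalence.from (outside⇔∉ W≡ω) (a∉X ∘ inj₂) ,
      v , (λ j j′ j≢j′ eq → j≢j′ (v-inj eq)) ,
      (λ j → Equivalence.from (outside⇔∉ W≡ω) (U∩W≡∅ (v j) (Equivalence.from (U≡v _) (j , refl)))) ,
      Equivalence.from (outside⇔∉ U≡v) (a∉X ∘ inj₁) ,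
      sep⇒distinguished W≡ω U≡v a∉X sep
      where W≡ω = enum-isImage W

    InSᵤ⇒Sepᵤ : ∀ {a} → InSᵤ u (enum W) a → Sepᵤ K u W a
    InSᵤ⇒Sepᵤ {a} (a∉ω , v , v-distinct , v∉ω , a∉v , dist) =
      image v ,
      disjoint ,
      isImage⇒∣∣≡ (distinct⇒injective v-distinct) U≡v ,
      distinguished⇒sep W≡ω U≡v dist ,
      [ Equivalence.to (outside⇔∉ U≡v) a∉v , Equivalence.to (outside⇔∉ W≡ω) a∉ω ]
      where
      W≡ω = enum-isImage W
      U≡v = image-isImage v
      disjoint : ∀ z → z ∈ image v → z ∉ W
      disjoint z z∈U with Equivalence.to (U≡v z) z∈U
      ... | j , refl = Equivalence.to (outside⇔∉ W≡ω) (v∉ω j)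

-- The defining sentence

module Construction (G : Graph) (u : ℕ) (W : Subset (n G)) where

  w : ℕ
  w = ∣ W ∣

  enumW : Fin w → Fin (n G)
  enumW = enum W

  Y : Fin (n G) → Set
  Y = Semantics.InSᵤ G u enumW

  Y? : ∀ y → Dec (Y y)
  Y? y = map-dec (Semantics.Sat-sepᵤ G u (extend y enumW) (λ _ → refl) zero refl)
                 (Semantics.Sat? G (extend y enumW) (sepᵤᶠ u suc zero))

  R : Fin (n G) → Set
  R r = r ∉ W × ¬ Y r

  R? : ∀ r → Dec (R r)
  R? r = ¬? (r ∈? W) ×-dec ¬? (Y? r)

  patternW : Fin (n G) → Fin w → Bool
  patternW x i = adj G x (enumW i)

  YDetermined RDetermined : Set
  YDetermined = ∀ {y y′} → Y y → Y y′ → patternW y ≗ patternW y′ → y ≡ y′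
  RDetermined = ∀ {r r′} → R r → R r′ → patternW r ≗ patternW r′ →
                (∀ y → Y y → adj G r y ≡ adj G r′ y) → r ≡ r′

  forSᵤWithᶠ : ∀ {k} → (Fin w → Fin k) → (Fin w → Bool) → Formula (suc k) → Formula k
  forSᵤWithᶠ σ p ψ = ∀ᶠ (patternᶠ (suc ∘ σ) zero p ⇒ᶠ (sepᵤᶠ u (suc ∘ σ) zero ⇒ᶠ ψ))

  representsᶠ : ∀ {k} → (Fin w → Fin k) → Fin (n G) → Fin k → Formula k
  representsᶠ σ y z = forSᵤWithᶠ σ (patternW y) (zero ≐ suc z)

  -- lacksTypeᶠ is not neg ∘ hasTypeᶠ: negating forSᵤWithᶠ would cost an
  -- alternation. It contradicts hasTypeᶠ once every Y-vertex is represented.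
  hasTypeᶠ lacksTypeᶠ : ∀ {k} → (Fin w → Fin k) → Fin (n G) → Fin k → Formula k
  hasTypeᶠ σ r z = outsideᶠ σ z ∧ᶠ (patternᶠ σ z (patternW r) ∧ᶠ
    ⋀∈ (⊤ᶠ z) Y? (λ y → forSᵤWithᶠ σ (patternW y) (adjIs (adj G r y) (suc z) zero)))
  lacksTypeᶠ σ r z = amongᶠ σ z ∨ᶠ (neg (patternᶠ σ z (patternW r)) ∨ᶠ
    ⋁∈ (⊥ᶠ z) Y? (λ y → forSᵤWithᶠ σ (patternW y) (adjIs (not (adj G r y)) (suc z) zero)))

  representsSomeᶠ hasSomeTypeᶠ : ∀ {k} → (Fin w → Fin k) → Fin k → Formula k
  representsSomeᶠ σ z = ⋁∈ (⊥ᶠ z) Y? (λ y → representsᶠ σ y z)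
  hasSomeTypeᶠ    σ z = ⋁∈ (⊥ᶠ z) R? (λ r → hasTypeᶠ σ r z)

  σ₀ : Fin w → Fin (w + 0)
  σ₀ = _↑ˡ 0

  σ₁ : Fin w → Fin (suc (w + 0))
  σ₁ i = suc (σ₀ i)

  σ₂ : Fin w → Fin (suc (suc (w + 0)))
  σ₂ i = suc (σ₁ i)

  adj-Wᶠ Y-existsᶠ Y-adjᶠ coverᶠ R-existsᶠ R-uniqueᶠ R-adjᶠ descriptionᶠ : Formula (w + 0)
  adj-Wᶠ = ⋀ ⊤ₛ w (λ i → ⋀ ⊤ₛ w (λ j → adjIs (adj G (enumW i) (enumW j)) (σ₀ i) (σ₀ j)))
  Y-existsᶠ = ⋀∈ ⊤ₛ Y? (λ y → ∃ᶠ (patternᶠ σ₁ zero (patternW y) ∧ᶠ sepᵤᶠ u σ₁ zero))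
  Y-adjᶠ = ⋀∈ ⊤ₛ Y? (λ y → ⋀∈ ⊤ₛ Y? (λ y′ →
    forSᵤWithᶠ σ₀ (patternW y) (forSᵤWithᶠ σ₁ (patternW y′) (adjIs (adj G y y′) (suc zero) zero))))
  coverᶠ = ∀ᶠ (outsideᶠ σ₁ zero ⇒ᶠ (representsSomeᶠ σ₁ zero ∨ᶠ hasSomeTypeᶠ σ₁ zero))
  R-existsᶠ = ⋀∈ ⊤ₛ R? (λ r → ∃ᶠ (hasTypeᶠ σ₁ r zero ∧ᶠ neg (sepᵤᶠ u σ₁ zero)))
  R-uniqueᶠ = ⋀∈ ⊤ₛ R? (λ r → ∀ᶠ (∀ᶠ ((suc zero ≐ zero) ∨ᶠ (lacksTypeᶠ σ₂ r (suc zero) ∨ᶠ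
    (lacksTypeᶠ σ₂ r zero ∨ᶠ (representsSomeᶠ σ₂ (suc zero) ∨ᶠ representsSomeᶠ σ₂ zero))))))
  R-adjᶠ = ⋀∈ ⊤ₛ R? (λ r → ⋀∈ ⊤ₛ R? (λ r′ → ∀ᶠ (∀ᶠ (lacksTypeᶠ σ₂ r (suc zero) ∨ᶠ (lacksTypeᶠ σ₂ r′ zero ∨ᶠ
    (representsSomeᶠ σ₂ (suc zero) ∨ᶠ (representsSomeᶠ σ₂ zero ∨ᶠ adjIs (adj G r r′) (suc zero) zero)))))))
  descriptionᶠ = adj-Wᶠ ∧ᶠ (distinctᶠ σ₀ ∧ᶠ (Y-existsᶠ ∧ᶠ (Y-adjᶠ ∧ᶠ (coverᶠ ∧ᶠ (R-existsᶠ ∧ᶠ (R-uniqueᶠ ∧ᶠ R-adjᶠ))))))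

  defining : Sentence
  defining = ∃ⁿ w descriptionᶠ

  module Meaning (K : Graph) where
    open Semantics K

    ForSᵤWith : (Fin w → V) → (Fin w → Bool) → (V → Set) → Set
    ForSᵤWith ω p Q = ∀ a → HasPattern ω a p → InSᵤ u ω a → Q a

    Represents : (Fin w → V) → Fin (n G) → V → Set
    Represents ω y z = ForSᵤWith ω (patternW y) (_≡ z)

    HasType LacksType : (Fin w → V) → Fin (n G) → V → Set
    HasType ω r z = Outside ω z × (HasPattern ω z (patternW r) ×
      (∀ y → Y y → ForSᵤWith ω (patternW y) (λ a → adj K z a ≡ adj G r y)))
    LacksType ω r z = Among ω z ⊎ (¬ HasPattern ω z (patternW r) ⊎
      ∃ λ y → Y y × ForSᵤWith ω (patternW y) (λ a → adj K z a ≡ not (adj G r y)))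

    RepresentsSome HasSomeType : (Fin w → V) → V → Set
    RepresentsSome ω z = ∃ λ y → Y y × Represents ω y z
    HasSomeType    ω z = ∃ λ r → R r × HasType ω r z

    module _ (ω : Fin w → V) where
      AdjW YExists YAdj Cover RExists RUnique RAdj : Set
      AdjW    = ∀ i j → adj K (ω i) (ω j) ≡ adj G (enumW i) (enumW j)
      YExists = ∀ y → Y y → ∃ λ a → HasPattern ω a (patternW y) × InSᵤ u ω a
      YAdj    = ∀ y → Y y → ∀ y′ → Y y′ →
                ForSᵤWith ω (patternW y) (λ b → ForSᵤWith ω (patternW y′) (λ a → adj K b a ≡ adj G y y′))
      Cover   = ∀ z → Outside ω z → RepresentsSome ω z ⊎ HasSomeType ω z
      RExists = ∀ r → R r → ∃ λ z → HasType ω r z × ¬ InSᵤ u ω z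
      RUnique = ∀ r → R r → ∀ z z′ →
                z ≡ z′ ⊎ (LacksType ω r z ⊎ (LacksType ω r z′ ⊎ (RepresentsSome ω z ⊎ RepresentsSome ω z′)))
      RAdj    = ∀ r → R r → ∀ r′ → R r′ → ∀ z z′ →
                LacksType ω r z ⊎ (LacksType ω r′ z′ ⊎ (RepresentsSome ω z ⊎ (RepresentsSome ω z′ ⊎ adj K z z′ ≡ adj G r r′)))

      record Describes : Set where
        constructor describes
        field
          adj-W      : AdjW
          W-distinct : Distinct ω
          Y-exists   : YExists
          Y-adj      : YAdj
          cover      : Cover
          R-exists   : RExists
          R-unique   : RUnique
          R-adj      : RAdj

    module _ {k} (ρ : Env K k) {σ : Fin w → Fin k} {ω} (ρ∘σ≗ω : ρ ∘ σ ≗ ω) where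

      Sat-forSᵤWith : ∀ p ψ {Q : V → Set} → (∀ a → Sat K (extend a ρ) ψ ⇔ Q a) →
                      Sat K ρ (forSᵤWithᶠ σ p ψ) ⇔ ForSᵤWith ω p Q
      Sat-forSᵤWith p ψ Sat-ψ = ∀-cong λ a → let ρ′ = extend a ρ in
        ⇔-trans (Sat-⇒ᶠ ρ′ (patternᶠ (suc ∘ σ) zero p) _) (→-cong-⇔ (Sat-pattern ρ′ ρ∘σ≗ω zero p refl)
          (⇔-trans (Sat-⇒ᶠ ρ′ (sepᵤᶠ u (suc ∘ σ) zero) ψ) (→-cong-⇔ (Sat-sepᵤ u ρ′ ρ∘σ≗ω zero refl) (Sat-ψ a))))

      Sat-represents : ∀ y z → Sat K ρ (representsᶠ σ y z) ⇔ Represents ω y (ρ z)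
      Sat-represents y z = Sat-forSᵤWith (patternW y) (zero ≐ suc z) (λ a → ⇔-refl)

      Sat-hasType : ∀ r z → Sat K ρ (hasTypeᶠ σ r z) ⇔ HasType ω r (ρ z)
      Sat-hasType r z =
        Sat-outside ρ ρ∘σ≗ω z refl ×-⇔ Sat-pattern ρ ρ∘σ≗ω z (patternW r) refl ×-⇔
        ⇔-trans (Sat-⋀∈ ρ refl Y? _) (∀-cong λ y → →-cong-⇔ ⇔-refl
          (Sat-forSᵤWith (patternW y) _ (λ a → Sat-adjIs (extend a ρ) (adj G r y) (suc z) zero)))

      Sat-lacksType : ∀ r z → Sat K ρ (lacksTypeᶠ σ r z) ⇔ LacksType ω r (ρ z)
      Sat-lacksType r z =
        Sat-among ρ ρ∘σ≗ω z refl ⊎-⇔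
        ⇔-trans (Sat-neg ρ _) (¬-cong-⇔ (Sat-pattern ρ ρ∘σ≗ω z (patternW r) refl)) ⊎-⇔
        ⇔-trans (Sat-⋁∈ ρ (λ ¬refl → ¬refl refl) Y? _) (∃-cong λ y → ⇔-refl ×-⇔
          Sat-forSᵤWith (patternW y) _ (λ a → Sat-adjIs (extend a ρ) (not (adj G r y)) (suc z) zero))

      Sat-representsSome : ∀ z → Sat K ρ (representsSomeᶠ σ z) ⇔ RepresentsSome ω (ρ z)
      Sat-representsSome z = ⇔-trans (Sat-⋁∈ ρ (λ ¬refl → ¬refl refl) Y? _) (∃-cong λ y → ⇔-refl ×-⇔ Sat-represents y z)

      Sat-hasSomeType : ∀ z → Sat K ρ (hasSomeTypeᶠ σ z) ⇔ HasSomeType ω (ρ z)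
      Sat-hasSomeType z = ⇔-trans (Sat-⋁∈ ρ (λ ¬refl → ¬refl refl) R? _) (∃-cong λ r → ⇔-refl ×-⇔ Sat-hasType r z)

    Sat-description : ∀ ω → Sat K (ω ++ noVars) descriptionᶠ ⇔ Describes ω
    Sat-description ω = ⇔-trans
      (Sat-adj-W ×-⇔ Sat-distinct ρ₀ ρ₀∘σ₀≗ω ×-⇔ Sat-Y-exists ×-⇔ Sat-Y-adj ×-⇔ Sat-cover ×-⇔
       Sat-R-exists ×-⇔ Sat-R-unique ×-⇔ Sat-R-adj)
      (mk⇔ (λ (a , b , c , d , e , f , g , h) → describes a b c d e f g h)
           (λ (describes a b c d e f g h) → a , b , c , d , e , f , g , h))
      where
      ρ₀ : Env K (w + 0)
      ρ₀ = ω ++ noVars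
      ρ₀∘σ₀≗ω : ρ₀ ∘ σ₀ ≗ ω
      ρ₀∘σ₀≗ω = lookup-++ˡ ω noVars

      Sat-adj-W : Sat K ρ₀ adj-Wᶠ ⇔ AdjW ω
      Sat-adj-W = ⇔-trans (Sat-⋀ ρ₀ (λ _ → refl) w _) (∀-cong λ i → ⇔-trans (Sat-⋀ ρ₀ (λ _ → refl) w _) (∀-cong λ j →
        ⇔-trans (Sat-adjIs ρ₀ _ (σ₀ i) (σ₀ j)) (subst₂-⇔ (λ a b → adj K a b ≡ _) (ρ₀∘σ₀≗ω i) (ρ₀∘σ₀≗ω j))))
      Sat-Y-exists : Sat K ρ₀ Y-existsᶠ ⇔ YExists ω
      Sat-Y-exists = ⇔-trans (Sat-⋀∈ ρ₀ (λ _ → refl) Y? _) (∀-cong λ y → →-cong-⇔ ⇔-refl (∃-cong λ a →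
        Sat-pattern (extend a ρ₀) ρ₀∘σ₀≗ω zero (patternW y) refl ×-⇔ Sat-sepᵤ u (extend a ρ₀) ρ₀∘σ₀≗ω zero refl))
      Sat-Y-adj : Sat K ρ₀ Y-adjᶠ ⇔ YAdj ω
      Sat-Y-adj = ⇔-trans (Sat-⋀∈ ρ₀ (λ _ → refl) Y? _) (∀-cong λ y → →-cong-⇔ ⇔-refl
        (⇔-trans (Sat-⋀∈ ρ₀ (λ _ → refl) Y? _) (∀-cong λ y′ → →-cong-⇔ ⇔-refl
          (Sat-forSᵤWith ρ₀ ρ₀∘σ₀≗ω (patternW y) (forSᵤWithᶠ σ₁ (patternW y′) (adjIs (adj G y y′) (suc zero) zero)) λ b →
            Sat-forSᵤWith (extend b ρ₀) ρ₀∘σ₀≗ω (patternW y′) (adjIs (adj G y y′) (suc zero) zero) λ a →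
              Sat-adjIs (extend a (extend b ρ₀)) (adj G y y′) (suc zero) zero))))
      Sat-cover : Sat K ρ₀ coverᶠ ⇔ Cover ω
      Sat-cover = ∀-cong λ z → let ρ = extend z ρ₀ in ⇔-trans (Sat-⇒ᶠ ρ _ _)
        (→-cong-⇔ (Sat-outside ρ ρ₀∘σ₀≗ω zero refl) (Sat-representsSome ρ ρ₀∘σ₀≗ω zero ⊎-⇔ Sat-hasSomeType ρ ρ₀∘σ₀≗ω zero))
      Sat-R-exists : Sat K ρ₀ R-existsᶠ ⇔ RExists ω
      Sat-R-exists = ⇔-trans (Sat-⋀∈ ρ₀ (λ _ → refl) R? _) (∀-cong λ r → →-cong-⇔ ⇔-refl (∃-cong λ z → let ρ = extend z ρ₀ in
        Sat-hasType ρ ρ₀∘σ₀≗ω r zero ×-⇔ ⇔-trans (Sat-neg ρ (sepᵤᶠ u σ₁ zero)) (¬-cong-⇔ (Sat-sepᵤ u ρ ρ₀∘σ₀≗ω zero refl))))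
      Sat-R-unique : Sat K ρ₀ R-uniqueᶠ ⇔ RUnique ω
      Sat-R-unique = ⇔-trans (Sat-⋀∈ ρ₀ (λ _ → refl) R? _) (∀-cong λ r → →-cong-⇔ ⇔-refl
        (∀-cong λ z → ∀-cong λ z′ → let ρ = extend z′ (extend z ρ₀) in
          ⇔-refl ⊎-⇔ Sat-lacksType ρ ρ₀∘σ₀≗ω r (suc zero) ⊎-⇔ Sat-lacksType ρ ρ₀∘σ₀≗ω r zero ⊎-⇔
          Sat-representsSome ρ ρ₀∘σ₀≗ω (suc zero) ⊎-⇔ Sat-representsSome ρ ρ₀∘σ₀≗ω zero))
      Sat-R-adj : Sat K ρ₀ R-adjᶠ ⇔ RAdj ω
      Sat-R-adj = ⇔-trans (Sat-⋀∈ ρ₀ (λ _ → refl) R? _) (∀-cong λ r → →-cong-⇔ ⇔-refl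
        (⇔-trans (Sat-⋀∈ ρ₀ (λ _ → refl) R? _) (∀-cong λ r′ → →-cong-⇔ ⇔-refl
          (∀-cong λ z → ∀-cong λ z′ → let ρ = extend z′ (extend z ρ₀) in
            Sat-lacksType ρ ρ₀∘σ₀≗ω r (suc zero) ⊎-⇔ Sat-lacksType ρ ρ₀∘σ₀≗ω r′ zero ⊎-⇔
            Sat-representsSome ρ ρ₀∘σ₀≗ω (suc zero) ⊎-⇔ Sat-representsSome ρ ρ₀∘σ₀≗ω zero ⊎-⇔
            Sat-adjIs ρ (adj G r r′) (suc zero) zero))))

    Sat-defining : K ⊨ defining ⇔ ∃ Describes
    Sat-defining = ⇔-trans (Sat-∃ⁿ w noVars descriptionᶠ) (∃-cong Sat-description)

  shape-forSᵤWith : ∀ {k} (σ : Fin w → Fin k) p {ψ d} → u + 1 ≤ d → Shape ψ d 2 1 → Shape (forSᵤWithᶠ σ p ψ) (suc d) 2 1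
  shape-forSᵤWith σ p u+1≤d sψ = shape-∀ (shape-⇒ (shape-pattern (suc ∘ σ) zero p)
    (shape-⇒ (shape-weaken (shape-sepᵤ u (suc ∘ σ) zero) u+1≤d ≤-refl ≤-refl) sψ))

  shape-represents : ∀ {k} (σ : Fin w → Fin k) y z → Shape (representsᶠ σ y z) (suc (u + 1)) 2 1
  shape-represents σ y z = shape-forSᵤWith σ (patternW y) ≤-refl (shape-≐ zero (suc z))

  shape-hasType : ∀ {k} (σ : Fin w → Fin k) r z → Shape (hasTypeᶠ σ r z) (suc (u + 1)) 2 1
  shape-hasType σ r z = shape-∧ (shape-outside σ z) (shape-∧ (shape-pattern σ z (patternW r))
    (shape-⋀∈ Y? (shape-≐ z z) (λ y → shape-forSᵤWith σ (patternW y) ≤-refl (shape-adjIs _ (suc z) zero))))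

  shape-lacksType : ∀ {k} (σ : Fin w → Fin k) r z → Shape (lacksTypeᶠ σ r z) (suc (u + 1)) 2 1
  shape-lacksType σ r z = shape-∨ (shape-among σ z) (shape-∨ (shape-neg (shape-pattern σ z (patternW r)))
    (shape-⋁∈ Y? (shape-≠ z z) (λ y → shape-forSᵤWith σ (patternW y) ≤-refl (shape-adjIs _ (suc z) zero))))

  shape-representsSome : ∀ {k} (σ : Fin w → Fin k) z → Shape (representsSomeᶠ σ z) (suc (u + 1)) 2 1
  shape-representsSome σ z = shape-⋁∈ Y? (shape-≠ z z) (λ y → shape-represents σ y z)

  shape-hasSomeType : ∀ {k} (σ : Fin w → Fin k) z → Shape (hasSomeTypeᶠ σ z) (suc (u + 1)) 2 1
  shape-hasSomeType σ z = shape-⋁∈ R? (shape-≠ z z) (λ r → shape-hasType σ r z)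

  shape-description : Shape descriptionᶠ (3 + (u + 1)) 2 3
  shape-description =
    shape-∧ shape-adj-W (shape-∧ (shape-distinct σ₀) (shape-∧ shape-Y-exists (shape-∧ shape-Y-adj
      (shape-∧ shape-cover (shape-∧ shape-R-exists (shape-∧ shape-R-unique shape-R-adj))))))
    where
    d = u + 1
    d≤2+d : d ≤ 2 + d
    d≤2+d = ≤-trans (n≤1+n d) (n≤1+n (suc d))

    shape-adj-W : Shape adj-Wᶠ (3 + d) 2 3
    shape-adj-W = shape-⋀ w shape-⊤ₛ (λ i → shape-⋀ w shape-⊤ₛ (λ j → shape-adjIs _ (σ₀ i) (σ₀ j)))

    shape-Y-exists : Shape Y-existsᶠ (3 + d) 2 3
    shape-Y-exists = shape-⋀∈ Y? shape-⊤ₛ (λ y → shape-weaken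
      (shape-∃ (shape-∧ (shape-pattern σ₁ zero (patternW y)) (shape-sepᵤ u σ₁ zero)))
      (s≤s d≤2+d) (n≤1+n 1) (n≤1+n 2))

    shape-Y-adj : Shape Y-adjᶠ (3 + d) 2 3
    shape-Y-adj = shape-⋀∈ Y? shape-⊤ₛ (λ y → shape-⋀∈ Y? shape-⊤ₛ (λ y′ → shape-weaken
      (shape-forSᵤWith σ₀ (patternW y) (n≤1+n d) (shape-forSᵤWith σ₁ (patternW y′) ≤-refl (shape-adjIs _ (suc zero) zero)))
      (n≤1+n (2 + d)) ≤-refl (m≤n+m 1 2)))

    shape-cover : Shape coverᶠ (3 + d) 2 3
    shape-cover = shape-weaken
      (shape-∀ (shape-⇒ (shape-outside σ₁ zero) (shape-∨ (shape-representsSome σ₁ zero) (shape-hasSomeType σ₁ zero))))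
      (n≤1+n (2 + d)) ≤-refl (m≤n+m 1 2)

    shape-R-exists : Shape R-existsᶠ (3 + d) 2 3
    shape-R-exists = shape-⋀∈ R? shape-⊤ₛ (λ r → shape-weaken
      (shape-∃ (shape-∧ (shape-hasType σ₁ r zero) (shape-weaken (shape-neg (shape-sepᵤ u σ₁ zero)) (n≤1+n d) ≤-refl ≤-refl)))
      (n≤1+n (2 + d)) ≤-refl ≤-refl)

    shape-R-unique : Shape R-uniqueᶠ (3 + d) 2 3
    shape-R-unique = shape-⋀∈ R? shape-⊤ₛ (λ r → shape-weaken
      (shape-∀ (shape-∀ (shape-∨ (shape-≐ (suc zero) zero) (shape-∨ (shape-lacksType σ₂ r (suc zero))
        (shape-∨ (shape-lacksType σ₂ r zero) (shape-∨ (shape-representsSome σ₂ (suc zero)) (shape-representsSome σ₂ zero)))))))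
      ≤-refl ≤-refl (m≤n+m 1 2))

    shape-R-adj : Shape R-adjᶠ (3 + d) 2 3
    shape-R-adj = shape-⋀∈ R? shape-⊤ₛ (λ r → shape-⋀∈ R? shape-⊤ₛ (λ r′ → shape-weaken
      (shape-∀ (shape-∀ (shape-∨ (shape-lacksType σ₂ r (suc zero)) (shape-∨ (shape-lacksType σ₂ r′ zero)
        (shape-∨ (shape-representsSome σ₂ (suc zero)) (shape-∨ (shape-representsSome σ₂ zero) (shape-adjIs _ (suc zero) zero)))))))
      ≤-refl ≤-refl (m≤n+m 1 2)))

  shape-defining : Shape defining (w + (3 + (u + 1))) 2 3
  shape-defining = shape-∃ⁿ w shape-description ≤-refl

  module _ (Y-determined : YDetermined) (R-determined : RDetermined) where
    open Semantics G
    open Meaning G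

    forSᵤWith-self : ∀ {y} {Q : Fin (n G) → Set} → Y y → Q y → ForSᵤWith enumW (patternW y) Q
    forSᵤWith-self {Q = Q} Yy Qy a a-pattern Ya = ≡.subst Q (Y-determined Yy Ya (≡.sym ∘ a-pattern)) Qy

    hasType-self : ∀ {r} → R r → HasType enumW r r
    hasType-self (r∉W , _) =
      Equivalence.from (outside⇔∉ G (enum-isImage W)) r∉W , (λ _ → refl) , (λ y Yy → forSᵤWith-self Yy refl)

    hasType⇒≡ : ∀ {r z} → R r → HasType enumW r z → ¬ Y z → z ≡ r
    hasType⇒≡ Rr (z∉ω , z-pattern , z-adjY) ¬Yz =
      R-determined (Equivalence.to (outside⇔∉ G (enum-isImage W)) z∉ω , ¬Yz) Rr z-pattern
                   (λ y Yy → z-adjY y Yy y (λ _ → refl) Yy)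

    lacksType-or-hasType : ∀ r z → LacksType enumW r z ⊎ HasType enumW r z
    lacksType-or-hasType r z with any? (λ i → z ≟ enumW i)
    ... | yes z∈ω = inj₁ (inj₁ z∈ω)
    ... | no z∉ω with all? (λ i → adj G z (enumW i) ≟ᴮ patternW r i)
    ...   | no ¬pattern = inj₁ (inj₂ (inj₁ ¬pattern))
    ...   | yes z-pattern with any? (λ y → Y? y ×-dec ¬? (adj G z y ≟ᴮ adj G r y))
    ...     | yes (y , Yy , ne) = inj₁ (inj₂ (inj₂ (y , Yy , forSᵤWith-self Yy (¬-not ne))))
    ...     | no ¬differs = inj₂ ((λ i eq → z∉ω (i , eq)) , z-pattern , λ y Yy →
                              forSᵤWith-self Yy (decidable-stable (_ ≟ᴮ _) (λ ne → ¬differs (y , Yy , ne))))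

    type-trichotomy : ∀ {r} → R r → ∀ z → z ≡ r ⊎ (LacksType enumW r z ⊎ RepresentsSome enumW z)
    type-trichotomy {r} Rr z with Y? z
    ... | yes Yz = inj₂ (inj₂ (z , Yz , forSᵤWith-self Yz refl))
    ... | no ¬Yz with lacksType-or-hasType r z
    ...   | inj₁ lacks = inj₂ (inj₁ lacks)
    ...   | inj₂ has   = inj₁ (hasType⇒≡ Rr has ¬Yz)

    describes-G : Describes enumW
    describes-G = describes
      (λ _ _ → refl) (λ _ _ i≢j eq → i≢j (enum-injective W eq))
      (λ y Yy → y , (λ _ → refl) , Yy)
      (λ y Yy y′ Yy′ → forSᵤWith-self Yy (forSᵤWith-self Yy′ refl))
      cover (λ r Rr → r , hasType-self Rr , proj₂ Rr) unique adjacent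
      where
      cover : Cover enumW
      cover z z∉ω with Y? z
      ... | yes Yz = inj₁ (z , Yz , forSᵤWith-self Yz refl)
      ... | no ¬Yz = inj₂ (z , Rz , hasType-self Rz)
        where Rz = Equivalence.to (outside⇔∉ G (enum-isImage W)) z∉ω , ¬Yz

      unique : RUnique enumW
      unique r Rr z z′ with type-trichotomy Rr z | type-trichotomy Rr z′
      ... | inj₂ (inj₁ lacks) | _                  = inj₂ (inj₁ lacks)
      ... | inj₂ (inj₂ rep)   | _                  = inj₂ (inj₂ (inj₂ (inj₁ rep)))
      ... | inj₁ _            | inj₂ (inj₁ lacks)  = inj₂ (inj₂ (inj₁ lacks))
      ... | inj₁ _            | inj₂ (inj₂ rep)    = inj₂ (inj₂ (inj₂ (inj₂ rep)))
      ... | inj₁ z≡r          | inj₁ z′≡r          = inj₁ (≡.trans z≡r (≡.sym z′≡r))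

      adjacent : RAdj enumW
      adjacent r Rr r′ Rr′ z z′ with type-trichotomy Rr z | type-trichotomy Rr′ z′
      ... | inj₂ (inj₁ lacks) | _                  = inj₁ lacks
      ... | inj₂ (inj₂ rep)   | _                  = inj₂ (inj₂ (inj₁ rep))
      ... | inj₁ _            | inj₂ (inj₁ lacks)  = inj₂ (inj₁ lacks)
      ... | inj₁ _            | inj₂ (inj₂ rep)    = inj₂ (inj₂ (inj₂ (inj₁ rep)))
      ... | inj₁ z≡r          | inj₁ z′≡r′         = inj₂ (inj₂ (inj₂ (inj₂ (cong₂ (adj G) z≡r z′≡r′))))

    G⊨defining : G ⊨ defining
    G⊨defining = Equivalence.from Sat-defining (enumW , describes-G)

  module _ (Y-determined : YDetermined) (R-determined : RDetermined)
           (H : Graph) (ω : Fin w → Fin (n H)) (D : Meaning.Describes H ω) where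
    open Semantics H
    open Meaning H
    open Describes D

    hasType⇒¬lacksType : ∀ {r z} → HasType ω r z → ¬ LacksType ω r z
    hasType⇒¬lacksType (z∉ω , _ , _) (inj₁ (i , eq)) = z∉ω i eq
    hasType⇒¬lacksType (_ , z-pattern , _) (inj₂ (inj₁ ¬pattern)) = ¬pattern z-pattern
    hasType⇒¬lacksType (_ , _ , z-adjY) (inj₂ (inj₂ (y , Yy , z-nonadjY))) =
      let (a , a-pattern , Sa) = Y-exists y Yy in not-¬ (z-adjY y Yy a a-pattern Sa) (z-nonadjY a a-pattern Sa)

    representsSome⇒InSᵤ : ∀ {z} → RepresentsSome ω z → InSᵤ u ω z
    representsSome⇒InSᵤ (y , Yy , rep) = let (a , a-pattern , Sa) = Y-exists y Yy in ≡.subst (InSᵤ u ω) (rep a a-pattern Sa) Sa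

    data Image (x : Fin (n G)) (z : V) : Set where
      W-image : ∀ i → x ≡ enumW i → z ≡ ω i → Image x z
      Y-image : Y x → HasPattern ω z (patternW x) → InSᵤ u ω z → Image x z
      R-image : R x → HasType ω x z → ¬ InSᵤ u ω z → Image x z

    image-pattern : ∀ {x z} → Image x z → HasPattern ω z (patternW x)
    image-pattern (W-image i refl refl) j = adj-W i j
    image-pattern (Y-image _ z-pattern _) = z-pattern
    image-pattern (R-image _ (_ , z-pattern , _) _) = z-pattern

    image-of-W : ∀ {i z} → Image (enumW i) z → z ≡ ω i
    image-of-W (W-image j eq refl) = cong ω (≡.sym (enum-injective W eq))
    image-of-W {i} (Y-image (enumWᵢ∉W , _) _ _) = ⊥-elim (enumWᵢ∉W i refl)
    image-of-W {i} (R-image (enumWᵢ∉W , _) _ _) = ⊥-elim (enumWᵢ∉W (enum-∈ W i))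

    image-of-ω : ∀ {i x} → Image x (ω i) → x ≡ enumW i
    image-of-ω (W-image j refl eq) = cong enumW (distinct⇒injective W-distinct (≡.sym eq))
    image-of-ω {i} (Y-image _ _ (ωᵢ∉ω , _)) = ⊥-elim (ωᵢ∉ω i refl)
    image-of-ω {i} (R-image _ (ωᵢ∉ω , _) _) = ⊥-elim (ωᵢ∉ω i refl)

    image-exists : ∀ x → ∃ (Image x)
    image-exists x with x ∈? W | Y? x
    ... | yes x∈W | _     = let (i , eq) = enum-surjective W x∈W in ω i , W-image i eq refl
    ... | no x∉W  | yes Yx = let (a , a-pattern , Sa) = Y-exists x Yx in a , Y-image Yx a-pattern Sa
    ... | no x∉W  | no ¬Yx = let (z , z-type , ¬Sz) = R-exists x (x∉W , ¬Yx) in z , R-image (x∉W , ¬Yx) z-type ¬Sz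

    image-adj : ∀ {x x′ z z′} → Image x z → Image x′ z′ → adj H z z′ ≡ adj G x x′
    image-adj (W-image i refl refl) im′ = ≡.trans (sym H _ _) (≡.trans (image-pattern im′ i) (sym G _ _))
    image-adj im (W-image j refl refl) = image-pattern im j
    image-adj (Y-image Yx z-pattern Sz) (Y-image Yx′ z′-pattern Sz′) = Y-adj _ Yx _ Yx′ _ z-pattern Sz _ z′-pattern Sz′
    image-adj (Y-image Yx z-pattern Sz) (R-image _ (_ , _ , z′-adjY) _) =
      ≡.trans (sym H _ _) (≡.trans (z′-adjY _ Yx _ z-pattern Sz) (sym G _ _))
    image-adj (R-image _ (_ , _ , z-adjY) _) (Y-image Yx′ z′-pattern Sz′) = z-adjY _ Yx′ _ z′-pattern Sz′
    image-adj (R-image Rx z-type ¬Sz) (R-image Rx′ z′-type ¬Sz′) with R-adj _ Rx _ Rx′ _ _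
    ... | inj₁ lacks = ⊥-elim (hasType⇒¬lacksType z-type lacks)
    ... | inj₂ (inj₁ lacks) = ⊥-elim (hasType⇒¬lacksType z′-type lacks)
    ... | inj₂ (inj₂ (inj₁ rep)) = ⊥-elim (¬Sz (representsSome⇒InSᵤ rep))
    ... | inj₂ (inj₂ (inj₂ (inj₁ rep))) = ⊥-elim (¬Sz′ (representsSome⇒InSᵤ rep))
    ... | inj₂ (inj₂ (inj₂ (inj₂ eq))) = eq

    image-injective : ∀ {x x′ z} → Image x z → Image x′ z → x ≡ x′
    image-injective (W-image i refl refl) im′ = ≡.sym (image-of-ω im′)
    image-injective im (W-image j refl refl) = image-of-ω im
    image-injective (Y-image Yx z-pattern _) (Y-image Yx′ z-pattern′ _) =
      Y-determined Yx Yx′ (λ i → ≡.trans (≡.sym (z-pattern i)) (z-pattern′ i))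
    image-injective (Y-image _ _ Sz) (R-image _ _ ¬Sz) = ⊥-elim (¬Sz Sz)
    image-injective (R-image _ _ ¬Sz) (Y-image _ _ Sz) = ⊥-elim (¬Sz Sz)
    image-injective (R-image Rx (_ , z-pattern , z-adjY) _) (R-image Rx′ (_ , z-pattern′ , z-adjY′) _) =
      R-determined Rx Rx′ (λ i → ≡.trans (≡.sym (z-pattern i)) (z-pattern′ i)) λ y Yy →
        let (a , a-pattern , Sa) = Y-exists y Yy in ≡.trans (≡.sym (z-adjY y Yy a a-pattern Sa)) (z-adjY′ y Yy a a-pattern Sa)

    image-of-Y : ∀ {y z} → Y y → Image y z → HasPattern ω z (patternW y) × InSᵤ u ω z
    image-of-Y (y∉ω , _) (W-image i refl _) = ⊥-elim (y∉ω i refl)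
    image-of-Y _ (Y-image _ z-pattern Sz) = z-pattern , Sz
    image-of-Y Yy (R-image (_ , ¬Yy) _ _) = ⊥-elim (¬Yy Yy)

    image-of-R : ∀ {r z} → R r → Image r z → HasType ω r z × ¬ InSᵤ u ω z
    image-of-R (r∉W , _) (W-image i refl _) = ⊥-elim (r∉W (enum-∈ W i))
    image-of-R (_ , ¬Yr) (Y-image Yr _ _) = ⊥-elim (¬Yr Yr)
    image-of-R _ (R-image _ z-type ¬Sz) = z-type , ¬Sz

    g : Fin (n G) → V
    g x = proj₁ (image-exists x)

    g-image : ∀ x → Image x (g x)
    g-image x = proj₂ (image-exists x)

    representsSome⇒∈range : ∀ {z} → RepresentsSome ω z → ∃ λ x → g x ≡ z
    representsSome⇒∈range (y , Yy , rep) = let (gy-pattern , Sgy) = image-of-Y Yy (g-image y) in y , rep (g y) gy-pattern Sgy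

    hasType⇒∈range : ∀ {r z} → R r → HasType ω r z → ∃ λ x → g x ≡ z
    hasType⇒∈range {r} {z} Rr z-type = from-R-unique (R-unique r Rr z (g r))
      where
      gr-type = proj₁ (image-of-R Rr (g-image r))
      ¬Sgr = proj₂ (image-of-R Rr (g-image r))
      from-R-unique : z ≡ g r ⊎ (LacksType ω r z ⊎ (LacksType ω r (g r) ⊎ (RepresentsSome ω z ⊎ RepresentsSome ω (g r)))) →
                      ∃ λ x → g x ≡ z
      from-R-unique (inj₁ z≡gr)                     = r , ≡.sym z≡gr
      from-R-unique (inj₂ (inj₁ lacks))             = ⊥-elim (hasType⇒¬lacksType z-type lacks)
      from-R-unique (inj₂ (inj₂ (inj₁ lacks)))      = ⊥-elim (hasType⇒¬lacksType gr-type lacks)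
      from-R-unique (inj₂ (inj₂ (inj₂ (inj₁ rep)))) = representsSome⇒∈range rep
      from-R-unique (inj₂ (inj₂ (inj₂ (inj₂ rep)))) = ⊥-elim (¬Sgr (representsSome⇒InSᵤ rep))

    g-surjective : ∀ z → ∃ λ x → g x ≡ z
    g-surjective z = by-cases (any? (λ i → z ≟ ω i))
      where
      by-cases : Dec (Among ω z) → ∃ λ x → g x ≡ z
      by-cases (yes (i , z≡ωᵢ)) = enumW i , ≡.trans (image-of-W (g-image (enumW i))) (≡.sym z≡ωᵢ)
      by-cases (no z∉ω) = [ representsSome⇒∈range , (λ (r , Rr , z-type) → hasType⇒∈range Rr z-type) ]′
                            (cover z (λ i eq → z∉ω (i , eq)))

    to : V → Fin (n G)
    to z = proj₁ (g-surjective z)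

    to-image : ∀ z → Image (to z) z
    to-image z = ≡.subst (Image (to z)) (proj₂ (g-surjective z)) (g-image (to z))

    H≅G : H ≅ G
    H≅G = record
      { to       = to
      ; from     = g
      ; from∘to  = proj₂ ∘ g-surjective
      ; to∘from  = λ x → image-injective (to-image (g x)) (g-image x)
      ; adj-pres = λ a b → ≡.sym (image-adj (to-image a) (to-image b))
      }

  defining-defines : YDetermined → RDetermined → Defines defining G
  defining-defines Y-det R-det = G⊨defining Y-det R-det , λ H H≇G H⊨defining →
    let (ω , D) = Equivalence.to (Meaning.Sat-defining H) H⊨defining in H≇G (H≅G Y-det R-det H ω D)

  module _ (sieve : IsSieve G (_∪ᵖ_ {G} (Sepᵤ G u W) (_∈ W)))
           (Y-separated : ∀ x y → Sepᵤ G u W x → Sepᵤ G u W y → x ≢ y → ¬ SameNbhdIn G (_∈ W) x y) where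

    sameNbhdInW : ∀ {x x′} → patternW x ≗ patternW x′ → SameNbhdIn G (_∈ W) x x′
    sameNbhdInW same-pattern z z∈W with enum-surjective W z∈W
    ... | i , refl = same-pattern i

    Y-determined : YDetermined
    Y-determined {y} {y′} Yy Yy′ same-pattern with y ≟ y′
    ... | yes y≡y′ = y≡y′
    ... | no y≢y′ = ⊥-elim (Y-separated y y′ (InSᵤ⇒Sepᵤ G u W Yy) (InSᵤ⇒Sepᵤ G u W Yy′) y≢y′ (sameNbhdInW same-pattern))

    R-determined : RDetermined
    R-determined {r} {r′} Rr Rr′ same-pattern same-adjY with r ≟ r′
    ... | yes r≡r′ = r≡r′
    ... | no r≢r′ = ⊥-elim (sieve r′ r r≢r′ (inj₂ (R⇒∉X Rr , R⇒∉X Rr′ , same)))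
      where
      R⇒∉X : ∀ {x} → R x → ¬ (Sepᵤ G u W x ⊎ x ∈ W)
      R⇒∉X (x∉W , ¬Yx) = [ ¬Yx ∘ Sepᵤ⇒InSᵤ G u W , x∉W ]
      same : SameNbhdIn G (_∪ᵖ_ {G} (Sepᵤ G u W) (_∈ W)) r r′
      same z (inj₁ z∈Sᵤ) = same-adjY z (Sepᵤ⇒InSᵤ G u W z∈Sᵤ)
      same z (inj₂ z∈W) = sameNbhdInW same-pattern z z∈W


lemma4p3 : (G : Graph) (W : Subset (n G)) (w u : ℕ) → ∣ W ∣ ≡ w →
    IsSieve G (_∪ᵖ_ {G} (Sepᵤ G u W) (_∈ W)) →
    (∀ x y → Sepᵤ G u W x → Sepᵤ G u W y → x ≢ y → ¬ SameNbhdIn G (_∈ W) x y) →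
    D₂≤ G (u + w + 4)
lemma4p3 G W w u refl sieve Y-separated =
  defining , negQF , ≤-trans (alternation≤alt∃ defining) alt∃≤ ,
  defining-defines (Y-determined sieve Y-separated) (R-determined sieve Y-separated) ,
  ≤-trans depth≤ (≤-reflexive (depth-bound u w))
  where
  open Construction G u W using (defining; shape-defining; defining-defines; Y-determined; R-determined)
  open Shape shape-defining
  depth-bound : ∀ a b → b + (3 + (a + 1)) ≡ a + b + 4
  depth-bound = solve-∀
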